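{- Let $n$ be an odd positive integer and $\Delta_n=\{\gamma\in B_n:\gamma_n>0\}$. Then \[\sum_{\gamma \in \Delta_n}(-1)^{\ell_B(\gamma)}q^{\operatorname{fmaj}(\gamma)}=[2]_{ -q}[4]_{q}\cdots[2n-2]_{q}\,[n]_{ -q},\] where the first $n-1$ factors are $[2i]_{(-1)^iq}$ for $i=1,\dots,n-1$.
   Context: For a positive integer $m$, $[m]_q:=\frac{1-q^m}{1-q}$, and $[m]_{ -q}$ is obtained by substituting $-q$ for $q$. $B_n$ is the group of bijections $\beta$ of $[-n,n]\setminus\{0\}$ with $\beta(-i)=-\beta(i)$, written in window notation $\beta=[\beta_1,\dots,\beta_n]$ with $\beta_i=\beta(i)$. For $\beta\in B_n$: $\operatorname{inv}(\beta)=|\{(i,j): 1\le i<j\le n,\ \beta_i>\beta_j\}|$ (usual order on integers); $\operatorname{N}_1(\beta)=|\{i:\beta_i<0\}|$; $\operatorname{N}_2(\beta)=|\{\{i,j\}: i\neq j,\ \beta_i+\beta_j<0\}|$; $\ell_B(\beta)=\operatorname{inv}(\beta)+\operatorname{N}_1(\beta)+\operatorname{N}_2(\beta)$. The descent set $\operatorname{Des}(\beta)$ is the set of $i\in[n-1]$ with $\beta_i\succ\beta_{i+1}$, where $\prec$ is the total order $-1\prec-2\prec\cdots\prec-n\prec 1\prec 2\prec\cdots\prec n$; $\operatorname{maj}(\beta)=\sum_{i\in\operatorname{Des}(\beta)}i$ and $\operatorname{fmaj}(\beta)=2\operatorname{maj}(\beta)+\operatorname{N}_1(\beta)$. (For $\gamma\in\Delta_n$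 the paper writes $\operatorname{Dmaj}(\gamma)=\operatorname{fmaj}(\gamma)$.) -}

module Defs where

open import Data.Nat as ℕ using (ℕ; zero; suc)
open import Data.Integer as ℤ using (ℤ; +_; -[1+_]; ∣_∣)
open import Data.Bool using (Bool; true; false; if_then_else_; _∧_; not)
open import Data.List using (List; []; _∷_; _++_; map; concatMap; filter; length; foldr; replicate; upTo; reverse)
open import Relation.Nullary using (does)
open import Relation.Nullary.Decidable using (⌊_⌋)

-- Polynomials in q with integer coefficients, as coefficient lists
-- (constant term first).  Equality is compared coefficientwise via coeff.

Poly : Set
Poly = List ℤ

coeff : Poly → ℕ → ℤ
coeff []       _       = + 0
coeff (c ∷ _)  zero    = c
coeff (_ ∷ cs) (suc d) = coeff cs d

_+P_ : Poly → Poly → Poly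
[]       +P qs       = qs
(p ∷ ps) +P []       = p ∷ ps
(p ∷ ps) +P (r ∷ rs) = (p ℤ.+ r) ∷ (ps +P rs)

scaleP : ℤ → Poly → Poly
scaleP c = map (c ℤ.*_)

_*P_ : Poly → Poly → Poly
[]       *P _  = []
(p ∷ ps) *P qs = scaleP p qs +P (+ 0 ∷ (ps *P qs))

monomial : ℤ → ℕ → Poly
monomial c d = replicate d (+ 0) ++ (c ∷ [])

sumP : List Poly → Poly
sumP = foldr _+P_ []

prodP : List Poly → Poly
prodP = foldr _*P_ (+ 1 ∷ [])

signPow : ℕ → ℤ
signPow zero    = + 1
signPow (suc k) = ℤ.- signPow k

qint : ℕ → Poly
qint m = map (λ _ → + 1) (upTo m)

qintNeg : ℕ → Poly
qintNeg m = map signPow (upTo m)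

qintSigned : ℕ → ℕ → Poly
qintSigned i m = map (λ k → signPow (i ℕ.* k)) (upTo m)

-- Hyperoctahedral group B_n in window notation: lists [β_1,...,β_n]
-- of integers in [-n,n]∖{0} whose absolute values are pairwise distinct.

alphabet : ℕ → List ℤ
alphabet n = map (λ i → -[1+ i ]) (upTo n) ++ map (λ i → + suc i) (upTo n)

words : ℕ → ℕ → List (List ℤ)
words n zero    = [] ∷ []
words n (suc m) = concatMap (λ x → map (x ∷_) (words n m)) (alphabet n)

allB : {A : Set} → (A → Bool) → List A → Bool
allB p []       = true
allB p (x ∷ xs) = p x ∧ allB p xs

absDistinct : List ℤ → Bool
absDistinct []       = true
absDistinct (x ∷ xs) = allB (λ y → not ⌊ ∣ x ∣ ℕ.≟ ∣ y ∣ ⌋) xs ∧ absDistinct xs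

Bn : ℕ → List (List ℤ)
Bn n = filter (λ w → absDistinct w Data.Bool.≟ true) (words n n)
  where import Data.Bool

lastPos : List ℤ → Bool
lastPos []           = false
lastPos (x ∷ [])     = ⌊ + 0 ℤ.<? x ⌋
lastPos (_ ∷ y ∷ ys) = lastPos (y ∷ ys)

Deltan : ℕ → List (List ℤ)
Deltan n = filter (λ w → lastPos w Data.Bool.≟ true) (Bn n)
  where import Data.Bool

count : {A : Set} → (A → Bool) → List A → ℕ
count p []       = 0
count p (x ∷ xs) = (if p x then 1 else 0) ℕ.+ count p xs

inv : List ℤ → ℕ
inv []       = 0
inv (x ∷ xs) = count (λ y → ⌊ y ℤ.<? x ⌋) xs ℕ.+ inv xs

N1 : List ℤ → ℕ
N1 = count (λ x → ⌊ x ℤ.<? + 0 ⌋)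

N2 : List ℤ → ℕ
N2 []       = 0
N2 (x ∷ xs) = count (λ y → ⌊ (x ℤ.+ y) ℤ.<? + 0 ⌋) xs ℕ.+ N2 xs

ellB : List ℤ → ℕ
ellB w = inv w ℕ.+ N1 w ℕ.+ N2 w

-- the total order -1 ≺ -2 ≺ ... ≺ -n ≺ 1 ≺ 2 ≺ ... ≺ n  (strict: x ≺ y)
precB : ℤ → ℤ → Bool
precB (+ _)    -[1+ _ ] = false
precB -[1+ _ ] (+ _)    = true
precB (+ a)    (+ b)    = ⌊ a ℕ.<? b ⌋
precB -[1+ a ] -[1+ b ] = ⌊ a ℕ.<? b ⌋

majFrom : ℕ → List ℤ → ℕ
majFrom i []           = 0
majFrom i (_ ∷ [])     = 0
majFrom i (x ∷ y ∷ ys) = (if precB y x then i else 0) ℕ.+ majFrom (suc i) (y ∷ ys)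

maj : List ℤ → ℕ
maj = majFrom 1

fmaj : List ℤ → ℕ
fmaj w = 2 ℕ.* maj w ℕ.+ N1 w

lhsPoly : ℕ → Poly
lhsPoly n = sumP (map (λ γ → monomial (signPow (ellB γ)) (fmaj γ)) (Deltan n))

rhsPoly : ℕ → Poly
rhsPoly n = prodP (map (λ j → qintSigned (suc j) (2 ℕ.* suc j)) (upTo (n ℕ.∸ 1))) *P qintNeg n

-- Peel letters off the right end of a signed word. Appending a letter v to a word w whose absolute values
-- avoid |v| multiplies (-1)^ℓ_B q^fmaj by (-1)^(a + [v<0]) q^(2d + [v<0]), where a is the number of letters
-- of w of absolute value larger than |v| (an earlier letter x changes inv + N₂ by an odd amount exactly when
-- |x| > |v|) and d is the position of the descent in front of v, or 0. By induction on M, the sum over the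
-- words w·v whose absolute values are exactly a set S of size M + 1 is
--   y^(#{s ∈ S : s > |v|} + (M+1)[v<0]) · [2]_{-q} [4]_q ⋯ [2M]_{(-1)^M q},   where y = (-1)^(M+1) q:
-- summing over the second-to-last letter u ∈ ±(S ∖ |v|), and writing q^(2d) = y′^(2d) for y′ = (-1)^M q,
-- the exponents of y′ run exactly once through an interval of length 2M, which gives y′^off [2M]_{y′}.
-- For S = {1, …, n} with n odd and v > 0 we have y = -q, and as v varies the exponent runs through
-- 0, …, n - 1, giving the last factor [n]_{-q}.

module Submission where

open import Defs
open import Data.Nat using (ℕ; suc; _+_; _*_)
open import Relation.Binary.PropositionalEquality using (_≡_)

open import Algebra.Bundles using (CommutativeMonoid)
import Algebra.Properties.CommutativeSemigroup as CommSemigroupProperties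
open import Data.Bool using (Bool; true; false; if_then_else_; _∧_; not; T)
import Data.Bool.Properties as BP
open import Data.Empty using (⊥-elim)
open import Data.Integer as ℤ using (ℤ; +_; -[1+_]; ∣_∣)
import Data.Integer.Properties as ℤP
import Data.Integer.Tactic.RingSolver as ℤRS
open import Data.List using (List; []; _∷_; _++_; map; concatMap; filter; replicate; upTo; applyUpTo; length)
import Data.List.Properties as LP
open import Data.List.Relation.Unary.All as All using (All; []; _∷_)
import Data.List.Relation.Unary.All.Properties as AllP
open import Data.Nat as ℕ using (zero; z≤n; _<ᵇ_; _≡ᵇ_)
import Data.Nat.Properties as ℕP
import Data.Nat.Tactic.RingSolver as ℕRS
open import Data.Product using (∃-syntax; _×_; _,_; proj₁; proj₂)
open import Data.Unit using (tt)
open import Level using (0ℓ)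
open import Relation.Binary.Bundles using (Setoid)
open import Relation.Binary.PropositionalEquality
import Relation.Binary.Reasoning.Setoid as SetoidReasoning
open import Relation.Nullary using (¬_)
open import Relation.Nullary.Decidable using (⌊_⌋; isYes≗does; toWitnessFalse)

open CommSemigroupProperties ℕP.+-commutativeSemigroup using ()
  renaming (interchange to +-interchange; x∙yz≈y∙xz to +-left-comm)
open CommSemigroupProperties (CommutativeMonoid.commutativeSemigroup BP.∧-commutativeMonoid) using ()
  renaming (interchange to ∧-interchange; xy∙z≈xz∙y to ∧-swapʳ)

infix 4 _≈_

record _≈_ (p r : Poly) : Set where
  constructor mk≈
  field at : ∀ d → coeff p d ≡ coeff r d

open _≈_

≈-setoid : Setoid 0ℓ 0ℓ
≈-setoid = record
  { Carrier       = Poly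
  ; _≈_           = _≈_
  ; isEquivalence = record
    { refl  = mk≈ λ _ → refl
    ; sym   = λ e → mk≈ λ d → sym (at e d)
    ; trans = λ e f → mk≈ λ d → trans (at e d) (at f d)
    }
  }

open Setoid ≈-setoid using () renaming (refl to ≈-refl; sym to ≈-sym; trans to ≈-trans; reflexive to ≈-reflexive)

module ≈-Reasoning = SetoidReasoning ≈-setoid

coeff-+P : ∀ p r d → coeff (p +P r) d ≡ coeff p d ℤ.+ coeff r d
coeff-+P []      r       d       = sym (ℤP.+-identityˡ (coeff r d))
coeff-+P (x ∷ p) []      d       = sym (ℤP.+-identityʳ _)
coeff-+P (x ∷ p) (y ∷ r) zero    = refl
coeff-+P (x ∷ p) (y ∷ r) (suc d) = coeff-+P p r d

coeff-scaleP : ∀ c p d → coeff (scaleP c p) d ≡ c ℤ.* coeff p d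
coeff-scaleP c []      d       = sym (ℤP.*-zeroʳ c)
coeff-scaleP c (x ∷ p) zero    = refl
coeff-scaleP c (x ∷ p) (suc d) = coeff-scaleP c p d

coeff-*P-zero : ∀ a p r → coeff ((a ∷ p) *P r) zero ≡ a ℤ.* coeff r zero
coeff-*P-zero a p r = trans (coeff-+P (scaleP a r) _ zero) (trans (ℤP.+-identityʳ _) (coeff-scaleP a r zero))

coeff-*P-suc : ∀ a p r d → coeff ((a ∷ p) *P r) (suc d) ≡ a ℤ.* coeff r (suc d) ℤ.+ coeff (p *P r) d
coeff-*P-suc a p r d = trans (coeff-+P (scaleP a r) _ (suc d)) (cong (ℤ._+ coeff (p *P r) d) (coeff-scaleP a r (suc d)))

∷-cong : ∀ {a b p r} → a ≡ b → p ≈ r → (a ∷ p) ≈ (b ∷ r)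
∷-cong e f = mk≈ λ { zero → e ; (suc d) → at f d }

0∷[]≈[] : (+ 0 ∷ []) ≈ []
0∷[]≈[] = mk≈ λ { zero → refl ; (suc d) → refl }

+P-identityʳ : ∀ p → p +P [] ≡ p
+P-identityʳ []      = refl
+P-identityʳ (x ∷ p) = refl

+P-cong : ∀ {p p′ r r′} → p ≈ p′ → r ≈ r′ → p +P r ≈ p′ +P r′
+P-cong {p} {p′} {r} {r′} e f = mk≈ λ d →
  trans (coeff-+P p r d) (trans (cong₂ ℤ._+_ (at e d) (at f d)) (sym (coeff-+P p′ r′ d)))

+P-comm : ∀ p r → p +P r ≈ r +P p
+P-comm p r = mk≈ λ d → trans (coeff-+P p r d) (trans (ℤP.+-comm (coeff p d) _) (sym (coeff-+P r p d)))

+P-assoc : ∀ p r s → (p +P r) +P s ≈ p +P (r +P s)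
+P-assoc p r s = mk≈ λ d → begin
  coeff ((p +P r) +P s) d                 ≡⟨ coeff-+P (p +P r) s d ⟩
  coeff (p +P r) d ℤ.+ coeff s d          ≡⟨ cong (ℤ._+ coeff s d) (coeff-+P p r d) ⟩
  (coeff p d ℤ.+ coeff r d) ℤ.+ coeff s d ≡⟨ ℤP.+-assoc (coeff p d) _ _ ⟩
  coeff p d ℤ.+ (coeff r d ℤ.+ coeff s d) ≡⟨ cong (λ z → coeff p d ℤ.+ z) (coeff-+P r s d) ⟨
  coeff p d ℤ.+ coeff (r +P s) d          ≡⟨ coeff-+P p (r +P s) d ⟨
  coeff (p +P (r +P s)) d                 ∎
  where open ≡-Reasoning

+P-interchange : ∀ a b c d → (a +P b) +P (c +P d) ≈ (a +P c) +P (b +P d)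
+P-interchange a b c d = begin
  (a +P b) +P (c +P d) ≈⟨ +P-assoc a b _ ⟩
  a +P (b +P (c +P d)) ≈⟨ +P-cong (≈-refl {a}) (+P-assoc b c d) ⟨
  a +P ((b +P c) +P d) ≈⟨ +P-cong (≈-refl {a}) (+P-cong (+P-comm b c) (≈-refl {d})) ⟩
  a +P ((c +P b) +P d) ≈⟨ +P-cong (≈-refl {a}) (+P-assoc c b d) ⟩
  a +P (c +P (b +P d)) ≈⟨ +P-assoc a c _ ⟨
  (a +P c) +P (b +P d) ∎
  where open ≈-Reasoning

*P-congʳ : ∀ p {r r′} → r ≈ r′ → p *P r ≈ p *P r′
*P-congʳ []      e = ≈-refl
*P-congʳ (a ∷ p) {r} {r′} e = mk≈ λ
  { zero    → trans (coeff-*P-zero a p r) (trans (cong (a ℤ.*_) (at e zero)) (sym (coeff-*P-zero a p r′)))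
  ; (suc d) → trans (coeff-*P-suc a p r d)
                (trans (cong₂ (λ x y → a ℤ.* x ℤ.+ y) (at e (suc d)) (at (*P-congʳ p e) d))
                       (sym (coeff-*P-suc a p r′ d)))
  }

*P-zeroʳ : ∀ p → p *P [] ≈ []
*P-zeroʳ []      = ≈-refl
*P-zeroʳ (a ∷ p) = mk≈ λ { zero → refl ; (suc d) → at (*P-zeroʳ p) d }

*P-consʳ : ∀ p b r → p *P (b ∷ r) ≈ scaleP b p +P (+ 0 ∷ (p *P r))
*P-consʳ []      b r = mk≈ λ { zero → refl ; (suc d) → refl }
*P-consʳ (a ∷ p) b r = mk≈ λ
  { zero    → trans (coeff-*P-zero a p (b ∷ r)) (trans (ℤP.*-comm a b) (sym (ℤP.+-identityʳ _)))
  ; (suc d) → begin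
      coeff ((a ∷ p) *P (b ∷ r)) (suc d)                       ≡⟨ coeff-*P-suc a p (b ∷ r) d ⟩
      a ℤ.* coeff r d ℤ.+ coeff (p *P (b ∷ r)) d               ≡⟨ cong (λ z → a ℤ.* coeff r d ℤ.+ z) (at (*P-consʳ p b r) d) ⟩
      a ℤ.* coeff r d ℤ.+ coeff (scaleP b p +P (+ 0 ∷ (p *P r))) d
        ≡⟨ cong (λ z → a ℤ.* coeff r d ℤ.+ z) (coeff-+P (scaleP b p) _ d) ⟩
      a ℤ.* coeff r d ℤ.+ (coeff (scaleP b p) d ℤ.+ coeff (+ 0 ∷ (p *P r)) d)
        ≡⟨ swap-left (a ℤ.* coeff r d) (coeff (scaleP b p) d) _ ⟩
      coeff (scaleP b p) d ℤ.+ (a ℤ.* coeff r d ℤ.+ coeff (+ 0 ∷ (p *P r)) d)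
        ≡⟨ cong (λ z → coeff (scaleP b p) d ℤ.+ z) (coeff-*P-zero-tail d) ⟨
      coeff (scaleP b p) d ℤ.+ coeff ((a ∷ p) *P r) d          ≡⟨ coeff-+P (scaleP b p) _ d ⟨
      coeff (scaleP b p +P ((a ∷ p) *P r)) d                   ∎
  }
  where
  open ≡-Reasoning
  swap-left : ∀ (x y z : ℤ) → x ℤ.+ (y ℤ.+ z) ≡ y ℤ.+ (x ℤ.+ z)
  swap-left = ℤRS.solve-∀
  coeff-*P-zero-tail : ∀ d → coeff ((a ∷ p) *P r) d ≡ a ℤ.* coeff r d ℤ.+ coeff (+ 0 ∷ (p *P r)) d
  coeff-*P-zero-tail d = trans (coeff-+P (scaleP a r) (+ 0 ∷ (p *P r)) d) (cong (ℤ._+ coeff (+ 0 ∷ (p *P r)) d) (coeff-scaleP a r d))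

*P-comm : ∀ p r → p *P r ≈ r *P p
*P-comm []      r = ≈-sym (*P-zeroʳ r)
*P-comm (a ∷ p) r = ≈-trans (+P-cong (≈-refl {scaleP a r}) (∷-cong refl (*P-comm p r))) (≈-sym (*P-consʳ r a p))

*P-congˡ : ∀ {p p′} r → p ≈ p′ → p *P r ≈ p′ *P r
*P-congˡ {p} {p′} r e = ≈-trans (*P-comm p r) (≈-trans (*P-congʳ r e) (*P-comm r p′))

*P-distribʳ : ∀ p r s → (p +P r) *P s ≈ (p *P s) +P (r *P s)
*P-distribʳ []      r       s = ≈-refl
*P-distribʳ (a ∷ p) []      s = ≈-reflexive (sym (+P-identityʳ ((a ∷ p) *P s)))
*P-distribʳ (a ∷ p) (b ∷ r) s = mk≈ λ
  { zero → begin
      coeff (((a ℤ.+ b) ∷ (p +P r)) *P s) zero                    ≡⟨ coeff-*P-zero (a ℤ.+ b) (p +P r) s ⟩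
      (a ℤ.+ b) ℤ.* coeff s zero                                  ≡⟨ ℤP.*-distribʳ-+ (coeff s zero) a b ⟩
      a ℤ.* coeff s zero ℤ.+ b ℤ.* coeff s zero                   ≡⟨ cong₂ ℤ._+_ (coeff-*P-zero a p s) (coeff-*P-zero b r s) ⟨
      coeff ((a ∷ p) *P s) zero ℤ.+ coeff ((b ∷ r) *P s) zero     ≡⟨ coeff-+P ((a ∷ p) *P s) _ zero ⟨
      coeff (((a ∷ p) *P s) +P ((b ∷ r) *P s)) zero                   ∎
  ; (suc d) → begin
      coeff (((a ℤ.+ b) ∷ (p +P r)) *P s) (suc d)                 ≡⟨ coeff-*P-suc (a ℤ.+ b) (p +P r) s d ⟩
      (a ℤ.+ b) ℤ.* coeff s (suc d) ℤ.+ coeff ((p +P r) *P s) d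
        ≡⟨ cong (λ z → (a ℤ.+ b) ℤ.* coeff s (suc d) ℤ.+ z) (trans (at (*P-distribʳ p r s) d) (coeff-+P (p *P s) _ d)) ⟩
      (a ℤ.+ b) ℤ.* coeff s (suc d) ℤ.+ (coeff (p *P s) d ℤ.+ coeff (r *P s) d)
        ≡⟨ distrib-interchange a b (coeff s (suc d)) _ _ ⟩
      (a ℤ.* coeff s (suc d) ℤ.+ coeff (p *P s) d) ℤ.+ (b ℤ.* coeff s (suc d) ℤ.+ coeff (r *P s) d)
        ≡⟨ cong₂ ℤ._+_ (coeff-*P-suc a p s d) (coeff-*P-suc b r s d) ⟨
      coeff ((a ∷ p) *P s) (suc d) ℤ.+ coeff ((b ∷ r) *P s) (suc d) ≡⟨ coeff-+P ((a ∷ p) *P s) _ (suc d) ⟨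
      coeff (((a ∷ p) *P s) +P ((b ∷ r) *P s)) (suc d)                ∎
  }
  where
  open ≡-Reasoning
  distrib-interchange : ∀ (a b x y z : ℤ) → (a ℤ.+ b) ℤ.* x ℤ.+ (y ℤ.+ z) ≡ (a ℤ.* x ℤ.+ y) ℤ.+ (b ℤ.* x ℤ.+ z)
  distrib-interchange = ℤRS.solve-∀

*P-distribˡ : ∀ s p r → s *P (p +P r) ≈ (s *P p) +P (s *P r)
*P-distribˡ s p r = ≈-trans (*P-comm s (p +P r)) (≈-trans (*P-distribʳ p r s) (+P-cong (*P-comm p s) (*P-comm r s)))

scaleP-*P : ∀ c p s → scaleP c p *P s ≈ scaleP c (p *P s)
scaleP-*P c []      s = ≈-refl
scaleP-*P c (a ∷ p) s = mk≈ λ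
  { zero → begin
      coeff ((c ℤ.* a ∷ scaleP c p) *P s) zero  ≡⟨ coeff-*P-zero (c ℤ.* a) (scaleP c p) s ⟩
      c ℤ.* a ℤ.* coeff s zero                  ≡⟨ ℤP.*-assoc c a _ ⟩
      c ℤ.* (a ℤ.* coeff s zero)                ≡⟨ cong (c ℤ.*_) (coeff-*P-zero a p s) ⟨
      c ℤ.* coeff ((a ∷ p) *P s) zero           ≡⟨ coeff-scaleP c ((a ∷ p) *P s) zero ⟨
      coeff (scaleP c ((a ∷ p) *P s)) zero      ∎
  ; (suc d) → begin
      coeff ((c ℤ.* a ∷ scaleP c p) *P s) (suc d)              ≡⟨ coeff-*P-suc (c ℤ.* a) (scaleP c p) s d ⟩
      c ℤ.* a ℤ.* coeff s (suc d) ℤ.+ coeff (scaleP c p *P s) d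
        ≡⟨ cong (λ z → c ℤ.* a ℤ.* coeff s (suc d) ℤ.+ z) (trans (at (scaleP-*P c p s) d) (coeff-scaleP c (p *P s) d)) ⟩
      c ℤ.* a ℤ.* coeff s (suc d) ℤ.+ c ℤ.* coeff (p *P s) d  ≡⟨ factor-left c a _ _ ⟩
      c ℤ.* (a ℤ.* coeff s (suc d) ℤ.+ coeff (p *P s) d)      ≡⟨ cong (c ℤ.*_) (coeff-*P-suc a p s d) ⟨
      c ℤ.* coeff ((a ∷ p) *P s) (suc d)                      ≡⟨ coeff-scaleP c ((a ∷ p) *P s) (suc d) ⟨
      coeff (scaleP c ((a ∷ p) *P s)) (suc d)                 ∎
  }
  where
  open ≡-Reasoning
  factor-left : ∀ (c a x y : ℤ) → c ℤ.* a ℤ.* x ℤ.+ c ℤ.* y ≡ c ℤ.* (a ℤ.* x ℤ.+ y)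
  factor-left = ℤRS.solve-∀

0∷-*P : ∀ p s → (+ 0 ∷ p) *P s ≈ + 0 ∷ (p *P s)
0∷-*P p s = mk≈ λ
  { zero    → coeff-*P-zero (+ 0) p s
  ; (suc d) → trans (coeff-*P-suc (+ 0) p s d) (ℤP.+-identityˡ _)
  }

*P-assoc : ∀ p r s → (p *P r) *P s ≈ p *P (r *P s)
*P-assoc []      r s = ≈-refl
*P-assoc (a ∷ p) r s = begin
  (scaleP a r +P (+ 0 ∷ (p *P r))) *P s ≈⟨ *P-distribʳ (scaleP a r) _ s ⟩
  (scaleP a r *P s) +P ((+ 0 ∷ (p *P r)) *P s)        ≈⟨ +P-cong (scaleP-*P a r s) (0∷-*P (p *P r) s) ⟩
  scaleP a (r *P s) +P (+ 0 ∷ ((p *P r) *P s))     ≈⟨ +P-cong (≈-refl {scaleP a (r *P s)}) (∷-cong refl (*P-assoc p r s)) ⟩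
  scaleP a (r *P s) +P (+ 0 ∷ (p *P (r *P s)))     ∎
  where open ≈-Reasoning

*P-identityˡ : ∀ p → (+ 1 ∷ []) *P p ≈ p
*P-identityˡ p = mk≈ λ
  { zero    → trans (coeff-*P-zero (+ 1) [] p) (ℤP.*-identityˡ _)
  ; (suc d) → trans (coeff-*P-suc (+ 1) [] p d) (trans (ℤP.+-identityʳ _) (ℤP.*-identityˡ _))
  }

*P-identityʳ : ∀ p → p *P (+ 1 ∷ []) ≈ p
*P-identityʳ p = ≈-trans (*P-comm p _) (*P-identityˡ p)

prodP-∷ʳ : ∀ xs x → prodP (xs ++ x ∷ []) ≈ prodP xs *P x
prodP-∷ʳ []       x = ≈-trans (*P-identityʳ x) (≈-sym (*P-identityˡ x))
prodP-∷ʳ (y ∷ xs) x = ≈-trans (*P-congʳ y (prodP-∷ʳ xs x)) (≈-sym (*P-assoc y (prodP xs) x))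

ΣP : {A : Set} → List A → (A → Poly) → Poly
ΣP xs f = sumP (map f xs)

ΣP-cong : {A : Set} (xs : List A) {f g : A → Poly} → (∀ x → f x ≈ g x) → ΣP xs f ≈ ΣP xs g
ΣP-cong []       e = ≈-refl
ΣP-cong (x ∷ xs) e = +P-cong (e x) (ΣP-cong xs e)

ΣP-cong-All : {A : Set} {P : A → Set} (xs : List A) {f g : A → Poly} →
              All P xs → (∀ x → P x → f x ≈ g x) → ΣP xs f ≈ ΣP xs g
ΣP-cong-All []       []         e = ≈-refl
ΣP-cong-All (x ∷ xs) (px ∷ pxs) e = +P-cong (e x px) (ΣP-cong-All xs pxs e)

ΣP-zero : {A : Set} (xs : List A) (f : A → Poly) → (∀ x → f x ≈ []) → ΣP xs f ≈ []
ΣP-zero []       f e = ≈-refl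
ΣP-zero (x ∷ xs) f e = +P-cong (e x) (ΣP-zero xs f e)

ΣP-++ : {A : Set} (xs ys : List A) (f : A → Poly) → ΣP (xs ++ ys) f ≈ ΣP xs f +P ΣP ys f
ΣP-++ []       ys f = ≈-refl
ΣP-++ (x ∷ xs) ys f = ≈-trans (+P-cong (≈-refl {f x}) (ΣP-++ xs ys f)) (≈-sym (+P-assoc (f x) _ _))

ΣP-map : {A B : Set} (g : A → B) (xs : List A) (f : B → Poly) → ΣP (map g xs) f ≈ ΣP xs (λ x → f (g x))
ΣP-map g []       f = ≈-refl
ΣP-map g (x ∷ xs) f = +P-cong (≈-refl {f (g x)}) (ΣP-map g xs f)

ΣP-concatMap : {A B : Set} (g : A → List B) (xs : List A) (f : B → Poly) →
               ΣP (concatMap g xs) f ≈ ΣP xs (λ x → ΣP (g x) f)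
ΣP-concatMap g []       f = ≈-refl
ΣP-concatMap g (x ∷ xs) f = ≈-trans (ΣP-++ (g x) (concatMap g xs) f) (+P-cong (≈-refl {ΣP (g x) f}) (ΣP-concatMap g xs f))

ΣP-+P : {A : Set} (xs : List A) (f g : A → Poly) → ΣP xs (λ x → f x +P g x) ≈ ΣP xs f +P ΣP xs g
ΣP-+P []       f g = ≈-refl
ΣP-+P (x ∷ xs) f g = ≈-trans (+P-cong (≈-refl {f x +P g x}) (ΣP-+P xs f g)) (+P-interchange (f x) (g x) _ _)

ΣP-*Pʳ : {A : Set} (xs : List A) (f : A → Poly) (r : Poly) → ΣP xs f *P r ≈ ΣP xs (λ x → f x *P r)
ΣP-*Pʳ []       f r = ≈-refl
ΣP-*Pʳ (x ∷ xs) f r = ≈-trans (*P-distribʳ (f x) _ r) (+P-cong (≈-refl {f x *P r}) (ΣP-*Pʳ xs f r))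

ΣP-*Pˡ : {A : Set} (xs : List A) (f : A → Poly) (r : Poly) → r *P ΣP xs f ≈ ΣP xs (λ x → r *P f x)
ΣP-*Pˡ xs f r = ≈-trans (*P-comm r _) (≈-trans (ΣP-*Pʳ xs f r) (ΣP-cong xs (λ x → *P-comm (f x) r)))

ΣP-swap : {A B : Set} (xs : List A) (ys : List B) (f : A → B → Poly) →
          ΣP xs (λ x → ΣP ys (f x)) ≈ ΣP ys (λ y → ΣP xs (λ x → f x y))
ΣP-swap []       ys f = ≈-sym (ΣP-zero ys _ (λ y → ≈-refl))
ΣP-swap (x ∷ xs) ys f = ≈-trans (+P-cong (≈-refl {ΣP ys (f x)}) (ΣP-swap xs ys f)) (≈-sym (ΣP-+P ys (f x) _))

ΣP-upTo-suc : ∀ n (f : ℕ → Poly) → ΣP (upTo (suc n)) f ≈ f 0 +P ΣP (upTo n) (λ i → f (suc i))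
ΣP-upTo-suc n f = +P-cong (≈-refl {f 0})
  (≈-trans (≈-reflexive (cong (λ l → ΣP l f) (sym (LP.map-upTo suc n)))) (ΣP-map suc (upTo n) f))

guard : Bool → Poly → Poly
guard b p = if b then p else []

guard-cong : ∀ {b b′ p r} → b ≡ b′ → (b ≡ true → p ≈ r) → guard b p ≈ guard b′ r
guard-cong {true}  refl e = e refl
guard-cong {false} refl e = ≈-refl

guard-*P : ∀ b r p → guard b (r *P p) ≈ r *P guard b p
guard-*P true  r p = ≈-refl
guard-*P false r p = ≈-sym (*P-zeroʳ r)

guard-swap : ∀ a b p → guard a (guard b p) ≡ guard b (guard a p)
guard-swap true  true  p = refl
guard-swap true  false p = refl
guard-swap false true  p = refl
guard-swap false false p = refl

ΣP-guard : {A : Set} (xs : List A) (b : Bool) (f : A → Poly) → ΣP xs (λ x → guard b (f x)) ≈ guard b (ΣP xs f)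
ΣP-guard xs true  f = ≈-refl
ΣP-guard xs false f = ΣP-zero xs _ (λ x → ≈-refl)

ΣP-filter : {A : Set} (P : A → Bool) (xs : List A) (f : A → Poly) →
            ΣP (filter (λ x → P x Data.Bool.≟ true) xs) f ≈ ΣP xs (λ x → guard (P x) (f x))
ΣP-filter P []       f = ≈-refl
ΣP-filter P (x ∷ xs) f with P x
... | true  = +P-cong (≈-refl {f x}) (ΣP-filter P xs f)
... | false = ΣP-filter P xs f

-- Powers of ±q and geometric sums

signPow-+ : ∀ a b → signPow (a + b) ≡ signPow a ℤ.* signPow b
signPow-+ zero    b = sym (ℤP.*-identityˡ _)
signPow-+ (suc a) b = trans (cong ℤ.-_ (signPow-+ a b)) (ℤP.neg-distribˡ-* (signPow a) (signPow b))

signPow-even : ∀ k → signPow (2 * k) ≡ + 1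
signPow-even zero    = refl
signPow-even (suc k) = trans (cong signPow (ℕP.*-suc 2 k)) (cong (λ z → ℤ.- (ℤ.- z)) (signPow-even k))

signPow-+-even : ∀ a k → signPow (a + 2 * k) ≡ signPow a
signPow-+-even a k = trans (signPow-+ a (2 * k)) (trans (cong (signPow a ℤ.*_) (signPow-even k)) (ℤP.*-identityʳ _))

shift : ℕ → Poly → Poly
shift k p = replicate k (+ 0) ++ p

shift-cong : ∀ k {p r} → p ≈ r → shift k p ≈ shift k r
shift-cong zero    e = e
shift-cong (suc k) e = ∷-cong refl (shift-cong k e)

shift-shift : ∀ a b p → shift a (shift b p) ≡ shift (a + b) p
shift-shift zero    b p = refl
shift-shift (suc a) b p = cong (+ 0 ∷_) (shift-shift a b p)

shift-[] : ∀ k → shift k [] ≈ []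
shift-[] zero    = ≈-refl
shift-[] (suc k) = ≈-trans (∷-cong refl (shift-[] k)) 0∷[]≈[]

shift-∷ : ∀ k x p → shift k (x ∷ p) ≈ monomial x k +P shift (suc k) p
shift-∷ zero    x p = ∷-cong (sym (ℤP.+-identityʳ x)) ≈-refl
shift-∷ (suc k) x p = ∷-cong refl (shift-∷ k x p)

scaleP-shift : ∀ c k p → scaleP c (shift k p) ≈ shift k (scaleP c p)
scaleP-shift c zero    p = ≈-refl
scaleP-shift c (suc k) p = ∷-cong (ℤP.*-zeroʳ c) (scaleP-shift c k p)

shift-*P : ∀ k p s → shift k p *P s ≈ shift k (p *P s)
shift-*P zero    p s = ≈-refl
shift-*P (suc k) p s = ≈-trans (0∷-*P (shift k p) s) (∷-cong refl (shift-*P k p s))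

monomial-*P : ∀ c k s → monomial c k *P s ≈ shift k (scaleP c s)
monomial-*P c k s = ≈-trans (shift-*P k (c ∷ []) s)
  (shift-cong k (≈-trans (+P-cong (≈-refl {scaleP c s}) 0∷[]≈[]) (≈-reflexive (+P-identityʳ _))))

monomial-*P-monomial : ∀ a i b j → monomial a i *P monomial b j ≈ monomial (a ℤ.* b) (i + j)
monomial-*P-monomial a i b j = begin
  monomial a i *P monomial b j        ≈⟨ monomial-*P a i (monomial b j) ⟩
  shift i (scaleP a (shift j (b ∷ []))) ≈⟨ shift-cong i (scaleP-shift a j (b ∷ [])) ⟩
  shift i (shift j (a ℤ.* b ∷ []))     ≡⟨ shift-shift i j _ ⟩
  monomial (a ℤ.* b) (i + j)           ∎
  where open ≈-Reasoning

signedQPow : ℕ → ℕ → Poly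
signedQPow m e = monomial (signPow (m * e)) e

signedQPow-*P : ∀ m a b → signedQPow m a *P signedQPow m b ≈ signedQPow m (a + b)
signedQPow-*P m a b = ≈-trans (monomial-*P-monomial _ a _ b)
  (≈-reflexive (cong (λ s → monomial s (a + b))
    (trans (sym (signPow-+ (m * a) (m * b))) (cong signPow (sym (ℕP.*-distribˡ-+ m a b))))))

monomial-*P-signedQPow : ∀ M s a off e k → a + off ≡ e → s + M * off + 2 * k ≡ suc M * e →
  monomial (signPow s) a *P signedQPow M off ≈ signedQPow (suc M) e
monomial-*P-signedQPow M s a off e k exponent parity = ≈-trans (monomial-*P-monomial (signPow s) a (signPow (M * off)) off)
  (≈-reflexive (cong₂ monomial sign exponent))
  where
  sign : signPow s ℤ.* signPow (M * off) ≡ signPow (suc M * e)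
  sign = trans (sym (signPow-+ s (M * off))) (trans (sym (signPow-+-even (s + M * off) k)) (cong signPow parity))

monomial-*P-signedQPow-even : ∀ M s d a e →
  monomial s (2 * d + a) *P signedQPow M e ≈ monomial s a *P signedQPow M (2 * d + e)
monomial-*P-signedQPow-even M s d a e = begin
  monomial s (2 * d + a) *P signedQPow M e                    ≈⟨ monomial-*P-monomial s (2 * d + a) (signPow (M * e)) e ⟩
  monomial (s ℤ.* signPow (M * e)) ((2 * d + a) + e)          ≡⟨ cong₂ (λ t k → monomial (s ℤ.* t) k) sign (shuffle d a e) ⟩
  monomial (s ℤ.* signPow (M * (2 * d + e))) (a + (2 * d + e)) ≈⟨ monomial-*P-monomial s a (signPow (M * (2 * d + e))) (2 * d + e) ⟨
  monomial s a *P signedQPow M (2 * d + e)                    ∎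
  where
  open ≈-Reasoning
  shuffle : ∀ d a e → (2 * d + a) + e ≡ a + (2 * d + e)
  shuffle = ℕRS.solve-∀
  distrib : ∀ M d e → M * (2 * d + e) ≡ M * e + 2 * (M * d)
  distrib = ℕRS.solve-∀
  sign : signPow (M * e) ≡ signPow (M * (2 * d + e))
  sign = sym (trans (cong signPow (distrib M d e)) (signPow-+-even (M * e) (M * d)))

geom : ℕ → ℕ → ℕ → Poly
geom m off zero      = []
geom m off (suc len) = signedQPow m off +P geom m (suc off) len

geom-++ : ∀ m off a b → geom m off (a + b) ≈ geom m off a +P geom m (off + a) b
geom-++ m off zero    b = ≈-reflexive (cong (λ o → geom m o b) (sym (ℕP.+-identityʳ off)))
geom-++ m off (suc a) b = begin
  signedQPow m off +P geom m (suc off) (a + b)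
    ≈⟨ +P-cong (≈-refl {signedQPow m off}) (geom-++ m (suc off) a b) ⟩
  signedQPow m off +P (geom m (suc off) a +P geom m (suc off + a) b)
    ≈⟨ +P-assoc (signedQPow m off) _ _ ⟨
  (signedQPow m off +P geom m (suc off) a) +P geom m (suc off + a) b
    ≡⟨ cong (λ o → (signedQPow m off +P geom m (suc off) a) +P geom m o b) (sym (ℕP.+-suc off a)) ⟩
  (signedQPow m off +P geom m (suc off) a) +P geom m (off + suc a) b ∎
  where open ≈-Reasoning

geom-++³ : ∀ m o x y z → geom m o (x + (y + z)) ≈ geom m o x +P (geom m (o + x) y +P geom m ((o + x) + y) z)
geom-++³ m o x y z = ≈-trans (geom-++ m o x (y + z)) (+P-cong (≈-refl {geom m o x}) (geom-++ m (o + x) y z))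

geom-∷ʳ : ∀ m off a → signedQPow m (off + a) +P geom m off a ≈ geom m off (suc a)
geom-∷ʳ m off a = begin
  signedQPow m (off + a) +P geom m off a           ≈⟨ +P-comm (signedQPow m (off + a)) (geom m off a) ⟩
  geom m off a +P signedQPow m (off + a)           ≡⟨ cong (geom m off a +P_) (sym (+P-identityʳ _)) ⟩
  geom m off a +P (signedQPow m (off + a) +P [])   ≈⟨ geom-++ m off a 1 ⟨
  geom m off (a + 1)                               ≡⟨ cong (geom m off) (ℕP.+-comm a 1) ⟩
  geom m off (suc a)                               ∎
  where open ≈-Reasoning

signedQPow-*P-geom : ∀ m o b len → signedQPow m o *P geom m b len ≈ geom m (o + b) len
signedQPow-*P-geom m o b zero      = *P-zeroʳ (signedQPow m o)
signedQPow-*P-geom m o b (suc len) = begin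
  signedQPow m o *P (signedQPow m b +P geom m (suc b) len)
    ≈⟨ *P-distribˡ (signedQPow m o) _ _ ⟩
  (signedQPow m o *P signedQPow m b) +P (signedQPow m o *P geom m (suc b) len)
    ≈⟨ +P-cong (signedQPow-*P m o b) (signedQPow-*P-geom m o (suc b) len) ⟩
  signedQPow m (o + b) +P geom m (o + suc b) len
    ≡⟨ cong (λ e → signedQPow m (o + b) +P geom m e len) (ℕP.+-suc o b) ⟩
  geom m (o + b) (suc len) ∎
  where open ≈-Reasoning

applyUpTo-cong : {A : Set} {f g : ℕ → A} (n : ℕ) → (∀ k → f k ≡ g k) → applyUpTo f n ≡ applyUpTo g n
applyUpTo-cong zero    e = refl
applyUpTo-cong (suc n) e = cong₂ _∷_ (e 0) (applyUpTo-cong n (λ k → e (suc k)))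

shift-applyUpTo≈geom : ∀ m off len → shift off (applyUpTo (λ k → signPow (m * (off + k))) len) ≈ geom m off len
shift-applyUpTo≈geom m off zero      = shift-[] off
shift-applyUpTo≈geom m off (suc len) = begin
  shift off (signPow (m * (off + 0)) ∷ rest)                 ≈⟨ shift-∷ off _ rest ⟩
  monomial (signPow (m * (off + 0))) off +P shift (suc off) rest
    ≡⟨ cong₂ (λ e r → monomial (signPow (m * e)) off +P shift (suc off) r) (ℕP.+-identityʳ off)
             (applyUpTo-cong len (λ k → cong (λ e → signPow (m * e)) (ℕP.+-suc off k))) ⟩
  signedQPow m off +P shift (suc off) (applyUpTo (λ k → signPow (m * (suc off + k))) len)
    ≈⟨ +P-cong (≈-refl {signedQPow m off}) (shift-applyUpTo≈geom m (suc off) len) ⟩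
  geom m off (suc len)                                        ∎
  where
  open ≈-Reasoning
  rest = applyUpTo (λ k → signPow (m * (off + suc k))) len

qintSigned≈geom : ∀ m len → qintSigned m len ≈ geom m 0 len
qintSigned≈geom m len = ≈-trans (≈-reflexive (LP.map-upTo _ len)) (shift-applyUpTo≈geom m 0 len)

signedQPow-*P-qintSigned : ∀ m off len → signedQPow m off *P qintSigned m len ≈ geom m off len
signedQPow-*P-qintSigned m off len =
  ≈-trans (*P-congʳ (signedQPow m off) (qintSigned≈geom m len))
          (≈-trans (signedQPow-*P-geom m off 0 len) (≈-reflexive (cong (λ o → geom m o len) (ℕP.+-identityʳ off))))

qintNeg≈geom : ∀ k → let n = suc (2 * k) in qintNeg n ≈ geom n 0 n
qintNeg≈geom k = ≈-trans (≈-reflexive (LP.map-cong (λ j → sym (odd-sign j)) (upTo (suc (2 * k))))) (qintSigned≈geom (suc (2 * k)) _)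
  where
  identity : ∀ k j → suc (2 * k) * j ≡ j + 2 * (k * j)
  identity = ℕRS.solve-∀
  odd-sign : ∀ j → signPow (suc (2 * k) * j) ≡ signPow j
  odd-sign j = trans (cong signPow (identity k j)) (signPow-+-even j (k * j))

qintProduct : ℕ → Poly
qintProduct M = prodP (map (λ j → qintSigned (suc j) (2 * suc j)) (upTo M))

qintProduct-suc : ∀ M → qintProduct (suc M) ≈ qintProduct M *P qintSigned (suc M) (2 * suc M)
qintProduct-suc M = begin
  prodP (map f (upTo (suc M)))            ≡⟨ cong (λ l → prodP (map f l)) (LP.upTo-∷ʳ M) ⟨
  prodP (map f (upTo M ++ M ∷ []))        ≡⟨ cong prodP (LP.map-++ f (upTo M) (M ∷ [])) ⟩
  prodP (map f (upTo M) ++ f M ∷ [])      ≈⟨ prodP-∷ʳ (map f (upTo M)) (f M) ⟩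
  qintProduct M *P f M                    ∎
  where
  open ≈-Reasoning
  f : ℕ → Poly
  f j = qintSigned (suc j) (2 * suc j)

boolToℕ : Bool → ℕ
boolToℕ b = if b then 1 else 0

∧-true⇒ : ∀ {a b} → a ∧ b ≡ true → a ≡ true × b ≡ true
∧-true⇒ {true} {true} _ = refl , refl

∧-implied : ∀ s t u → (t ≡ true → u ≡ true) → s ∧ t ≡ (s ∧ u) ∧ t
∧-implied s false u h = trans (BP.∧-zeroʳ s) (sym (BP.∧-zeroʳ (s ∧ u)))
∧-implied s true  u h rewrite h refl = sym (BP.∧-identityʳ (s ∧ true))

data Compareᵇ (a c : ℕ) : Set where
  less    : (a <ᵇ c) ≡ true  → (c <ᵇ a) ≡ false → (c ≡ᵇ a) ≡ false → Compareᵇ a c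
  equal   : (a <ᵇ c) ≡ false → (c <ᵇ a) ≡ false → (c ≡ᵇ a) ≡ true  → Compareᵇ a c
  greater : (a <ᵇ c) ≡ false → (c <ᵇ a) ≡ true  → (c ≡ᵇ a) ≡ false → Compareᵇ a c

compareᵇ : ∀ a c → Compareᵇ a c
compareᵇ zero    zero    = equal refl refl refl
compareᵇ zero    (suc c) = less refl refl refl
compareᵇ (suc a) zero    = greater refl refl refl
compareᵇ (suc a) (suc c) with compareᵇ a c
... | less    p q r = less p q r
... | equal   p q r = equal p q r
... | greater p q r = greater p q r

≡ᵇ-true⇒≡ : ∀ {m n} → (m ≡ᵇ n) ≡ true → m ≡ n
≡ᵇ-true⇒≡ {m} {n} e = ℕP.≡ᵇ⇒≡ m n (subst T (sym e) tt)

≡ᵇ-sym : ∀ m n → (m ≡ᵇ n) ≡ (n ≡ᵇ m)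
≡ᵇ-sym zero    zero    = refl
≡ᵇ-sym zero    (suc n) = refl
≡ᵇ-sym (suc m) zero    = refl
≡ᵇ-sym (suc m) (suc n) = ≡ᵇ-sym m n

≡ᵇ-refl : ∀ m → (m ≡ᵇ m) ≡ true
≡ᵇ-refl zero    = refl
≡ᵇ-refl (suc m) = ≡ᵇ-refl m

<ᵇ-trans : ∀ a b c → (a <ᵇ b) ≡ true → (b <ᵇ c) ≡ true → (a <ᵇ c) ≡ true
<ᵇ-trans zero    (suc b) (suc c) p q = refl
<ᵇ-trans (suc a) (suc b) (suc c) p q = <ᵇ-trans a b c p q

<ᵇ-asym : ∀ a b → (a <ᵇ b) ≡ true → (b <ᵇ a) ≡ false
<ᵇ-asym zero    (suc b) p = refl
<ᵇ-asym (suc a) (suc b) p = <ᵇ-asym a b p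

<ᵇ⇒≢ᵇ : ∀ a c → (a <ᵇ c) ≡ true → not (c ≡ᵇ a) ≡ true
<ᵇ⇒≢ᵇ zero    (suc c) _ = refl
<ᵇ⇒≢ᵇ (suc a) (suc c) h = <ᵇ⇒≢ᵇ a c h

allB-∷ʳ : {A : Set} (p : A → Bool) (w : List A) (v : A) → allB p (w ++ v ∷ []) ≡ allB p w ∧ p v
allB-∷ʳ p []      v = BP.∧-identityʳ (p v)
allB-∷ʳ p (x ∷ w) v = trans (cong (p x ∧_) (allB-∷ʳ p w v)) (sym (BP.∧-assoc (p x) _ _))

allB-∧ : {A : Set} (p q : A → Bool) (w : List A) → allB (λ x → p x ∧ q x) w ≡ allB p w ∧ allB q w
allB-∧ p q []      = refl
allB-∧ p q (x ∷ w) = trans (cong ((p x ∧ q x) ∧_) (allB-∧ p q w)) (∧-interchange (p x) (q x) (allB p w) (allB q w))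

allB-cong : {A : Set} {p q : A → Bool} (w : List A) → (∀ x → p x ≡ q x) → allB p w ≡ allB q w
allB-cong []      e = refl
allB-cong (x ∷ w) e = cong₂ _∧_ (e x) (allB-cong w e)

allB⇒All : {A : Set} (p : A → Bool) (w : List A) → allB p w ≡ true → All (λ x → p x ≡ true) w
allB⇒All p []      e = []
allB⇒All p (x ∷ w) e = proj₁ (∧-true⇒ {p x} e) ∷ allB⇒All p w (proj₂ (∧-true⇒ {p x} e))

-- Appending a letter to a signed word

Letter : ℕ → ℤ → Set
Letter n x = ∃[ i ] ∣ x ∣ ≡ suc i × i ℕ.< n

alphabet-Letter : ∀ n → All (Letter n) (alphabet n)
alphabet-Letter n = AllP.++⁺ (AllP.map⁺ (All.map (λ {i} i<n → i , refl , i<n) (AllP.all-upTo n)))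
                             (AllP.map⁺ (All.map (λ {i} i<n → i , refl , i<n) (AllP.all-upTo n)))

IsWord : ℕ → ℕ → List ℤ → Set
IsWord n m w = length w ≡ m × All (Letter n) w

words-IsWord : ∀ n m → All (IsWord n m) (words n m)
words-IsWord n zero    = (refl , []) ∷ []
words-IsWord n (suc m) = AllP.concat⁺ (AllP.map⁺ (All.map
  (λ x∈ → AllP.map⁺ (All.map (λ (len , ws) → cong suc len , x∈ ∷ ws) (words-IsWord n m)))
  (alphabet-Letter n)))

ΣP-words-∷ʳ : ∀ n m (f : List ℤ → Poly) →
              ΣP (words n (suc m)) f ≈ ΣP (words n m) (λ w → ΣP (alphabet n) (λ v → f (w ++ v ∷ [])))
ΣP-words-∷ʳ n zero    f = begin
  ΣP (concatMap (λ x → map (x ∷_) (words n zero)) (alphabet n)) f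
    ≈⟨ ΣP-concatMap _ (alphabet n) f ⟩
  ΣP (alphabet n) (λ x → f (x ∷ []) +P [])
    ≈⟨ ΣP-cong (alphabet n) (λ x → ≈-reflexive (+P-identityʳ (f (x ∷ [])))) ⟩
  ΣP (alphabet n) (λ x → f (x ∷ []))
    ≡⟨ +P-identityʳ _ ⟨
  ΣP (alphabet n) (λ x → f (x ∷ [])) +P [] ∎
  where open ≈-Reasoning
ΣP-words-∷ʳ n (suc m) f = begin
  ΣP (concatMap (λ x → map (x ∷_) (words n (suc m))) (alphabet n)) f
    ≈⟨ ΣP-concatMap _ (alphabet n) f ⟩
  ΣP (alphabet n) (λ x → ΣP (map (x ∷_) (words n (suc m))) f)
    ≈⟨ ΣP-cong (alphabet n) (λ x → ≈-trans (ΣP-map (x ∷_) (words n (suc m)) f) (ΣP-words-∷ʳ n m (λ w → f (x ∷ w)))) ⟩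
  ΣP (alphabet n) (λ x → ΣP (words n m) (λ w → ΣP (alphabet n) (λ v → f (x ∷ w ++ v ∷ []))))
    ≈⟨ ΣP-cong (alphabet n) (λ x → ΣP-map (x ∷_) (words n m) _) ⟨
  ΣP (alphabet n) (λ x → ΣP (map (x ∷_) (words n m)) (λ w → ΣP (alphabet n) (λ v → f (w ++ v ∷ []))))
    ≈⟨ ΣP-concatMap _ (alphabet n) _ ⟨
  ΣP (words n (suc m)) (λ w → ΣP (alphabet n) (λ v → f (w ++ v ∷ []))) ∎
  where open ≈-Reasoning

ΣP-alphabet : ∀ n (f : ℤ → Poly) → ΣP (alphabet n) f ≈ ΣP (upTo n) (λ i → f -[1+ i ]) +P ΣP (upTo n) (λ i → f (+ suc i))
ΣP-alphabet n f = ≈-trans (ΣP-++ (map -[1+_] (upTo n)) _ f)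
                          (+P-cong (ΣP-map -[1+_] (upTo n) f) (ΣP-map (λ i → + suc i) (upTo n) f))

isNeg : ℤ → Bool
isNeg v = ⌊ v ℤ.<? + 0 ⌋

isPos : ℤ → Bool
isPos v = ⌊ + 0 ℤ.<? v ⌋

count-∷ʳ : {A : Set} (p : A → Bool) (xs : List A) (v : A) → count p (xs ++ v ∷ []) ≡ count p xs + boolToℕ (p v)
count-∷ʳ p []       v = ℕP.+-identityʳ _
count-∷ʳ p (x ∷ xs) v = trans (cong (λ c → boolToℕ (p x) + c) (count-∷ʳ p xs v)) (sym (ℕP.+-assoc (boolToℕ (p x)) _ _))

inv-∷ʳ : ∀ w v → inv (w ++ v ∷ []) ≡ inv w + count (λ x → ⌊ v ℤ.<? x ⌋) w
inv-∷ʳ []      v = refl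
inv-∷ʳ (x ∷ w) v =
  trans (cong₂ _+_ (count-∷ʳ _ w v) (inv-∷ʳ w v)) (+-interchange (count (λ y → ⌊ y ℤ.<? x ⌋) w) _ (inv w) _)

N2-∷ʳ : ∀ w v → N2 (w ++ v ∷ []) ≡ N2 w + count (λ x → ⌊ (x ℤ.+ v) ℤ.<? + 0 ⌋) w
N2-∷ʳ []      v = refl
N2-∷ʳ (x ∷ w) v =
  trans (cong₂ _+_ (count-∷ʳ _ w v) (N2-∷ʳ w v)) (+-interchange (count (λ y → ⌊ (x ℤ.+ y) ℤ.<? + 0 ⌋) w) _ (N2 w) _)

majFrom-regroup : ∀ d m b i k → d + (m + (if b then suc i + k else 0)) ≡ (d + m) + (if b then i + suc k else 0)
majFrom-regroup d m b i k = trans (sym (ℕP.+-assoc d m _)) (cong (λ j → d + m + (if b then j else 0)) (sym (ℕP.+-suc i k)))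

majFrom-∷ʳ : ∀ i w u v →
  majFrom i ((w ++ u ∷ []) ++ v ∷ []) ≡ majFrom i (w ++ u ∷ []) + (if precB v u then i + length w else 0)
majFrom-∷ʳ i []          u v =
  trans (ℕP.+-identityʳ _) (cong (λ j → if precB v u then j else 0) (sym (ℕP.+-identityʳ i)))
majFrom-∷ʳ i (x ∷ [])    u v =
  trans (cong (λ m → (if precB u x then i else 0) + m) (majFrom-∷ʳ (suc i) [] u v))
        (majFrom-regroup (if precB u x then i else 0) (majFrom (suc i) (u ∷ [])) (precB v u) i 0)
majFrom-∷ʳ i (x ∷ y ∷ w) u v =
  trans (cong (λ m → (if precB y x then i else 0) + m) (majFrom-∷ʳ (suc i) (y ∷ w) u v))
        (majFrom-regroup (if precB y x then i else 0) (majFrom (suc i) (y ∷ w ++ u ∷ [])) (precB v u) i (length (y ∷ w)))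

isNeg-⊖ : ∀ m n → isNeg (m ℤ.⊖ n) ≡ (m <ᵇ n)
isNeg-⊖ zero    zero    = refl
isNeg-⊖ zero    (suc n) = refl
isNeg-⊖ (suc m) zero    = refl
isNeg-⊖ (suc m) (suc n) = trans (cong isNeg (ℤP.[1+m]⊖[1+n]≡m⊖n m n)) (isNeg-⊖ m n)

pairParity : ∀ x v → ¬ ∣ x ∣ ≡ ∣ v ∣ →
  signPow (boolToℕ ⌊ v ℤ.<? x ⌋ + boolToℕ ⌊ (x ℤ.+ v) ℤ.<? + 0 ⌋) ≡ signPow (boolToℕ (∣ v ∣ <ᵇ ∣ x ∣))
pairParity (+ c) (+ a) ne =
  trans (cong signPow (ℕP.+-identityʳ (boolToℕ ⌊ + a ℤ.<? + c ⌋)))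
        (cong (λ t → signPow (boolToℕ t)) (isYes≗does (+ a ℤ.<? + c)))
pairParity (+ c) -[1+ a ] ne =
  trans (cong (λ t → signPow (1 + boolToℕ t)) (isNeg-⊖ c (suc a))) (by-comparison (compareᵇ c (suc a)))
  where
  by-comparison : Compareᵇ c (suc a) → signPow (1 + boolToℕ (c <ᵇ suc a)) ≡ signPow (boolToℕ (suc a <ᵇ c))
  by-comparison (less p q _) rewrite p | q = refl
  by-comparison (equal _ _ r)              = ⊥-elim (ne (sym (≡ᵇ-true⇒≡ r)))
  by-comparison (greater p q _) rewrite p | q = refl
pairParity -[1+ b ] (+ a) ne = cong (λ t → signPow (boolToℕ t)) (isNeg-⊖ a (suc b))
pairParity -[1+ b ] -[1+ a ] ne =
  trans (cong (λ t → signPow (boolToℕ t + 1)) (isYes≗does (-[1+ a ] ℤ.<? -[1+ b ]))) (by-comparison (compareᵇ b a))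
  where
  by-comparison : Compareᵇ b a → signPow (boolToℕ (b <ᵇ a) + 1) ≡ signPow (boolToℕ (a <ᵇ b))
  by-comparison (less p q _) rewrite p | q = refl
  by-comparison (equal _ _ r)              = ⊥-elim (ne (cong suc (sym (≡ᵇ-true⇒≡ r))))
  by-comparison (greater p q _) rewrite p | q = refl

pairsParity : ∀ W v → All (λ x → ¬ ∣ x ∣ ≡ ∣ v ∣) W →
  signPow (count (λ x → ⌊ v ℤ.<? x ⌋) W + count (λ x → ⌊ (x ℤ.+ v) ℤ.<? + 0 ⌋) W)
    ≡ signPow (count (λ x → ∣ v ∣ <ᵇ ∣ x ∣) W)
pairsParity []      v []         = refl
pairsParity (x ∷ W) v (ne ∷ nes) = begin
  signPow ((a + A) + (b + B))                  ≡⟨ cong signPow (+-interchange a A b B) ⟩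
  signPow ((a + b) + (A + B))                  ≡⟨ signPow-+ (a + b) (A + B) ⟩
  signPow (a + b) ℤ.* signPow (A + B)          ≡⟨ cong₂ ℤ._*_ (pairParity x v ne) (pairsParity W v nes) ⟩
  signPow (boolToℕ (∣ v ∣ <ᵇ ∣ x ∣)) ℤ.* signPow (count (λ y → ∣ v ∣ <ᵇ ∣ y ∣) W)
    ≡⟨ signPow-+ (boolToℕ (∣ v ∣ <ᵇ ∣ x ∣)) _ ⟨
  signPow (count (λ y → ∣ v ∣ <ᵇ ∣ y ∣) (x ∷ W)) ∎
  where
  open ≡-Reasoning
  a = boolToℕ ⌊ v ℤ.<? x ⌋
  A = count (λ y → ⌊ v ℤ.<? y ⌋) W
  b = boolToℕ ⌊ (x ℤ.+ v) ℤ.<? + 0 ⌋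
  B = count (λ y → ⌊ (y ℤ.+ v) ℤ.<? + 0 ⌋) W

ellBIncrement : List ℤ → ℤ → ℕ
ellBIncrement W v = count (λ y → ∣ v ∣ <ᵇ ∣ y ∣) W + boolToℕ (isNeg v)

ellB-∷ʳ : ∀ W v → All (λ y → ¬ ∣ y ∣ ≡ ∣ v ∣) W →
          signPow (ellB (W ++ v ∷ [])) ≡ signPow (ellBIncrement W v) ℤ.* signPow (ellB W)
ellB-∷ʳ W v ne = begin
  signPow (ellB (W ++ v ∷ []))                          ≡⟨ cong signPow regroup ⟩
  signPow (((cA + cB) + nv) + ellB W)                   ≡⟨ signPow-+ ((cA + cB) + nv) (ellB W) ⟩
  signPow ((cA + cB) + nv) ℤ.* signPow (ellB W)         ≡⟨ cong (ℤ._* signPow (ellB W)) (signPow-+ (cA + cB) nv) ⟩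
  (signPow (cA + cB) ℤ.* signPow nv) ℤ.* signPow (ellB W)
    ≡⟨ cong (λ s → (s ℤ.* signPow nv) ℤ.* signPow (ellB W)) (pairsParity W v ne) ⟩
  (signPow (count (λ y → ∣ v ∣ <ᵇ ∣ y ∣) W) ℤ.* signPow nv) ℤ.* signPow (ellB W)
    ≡⟨ cong (ℤ._* signPow (ellB W)) (signPow-+ (count (λ y → ∣ v ∣ <ᵇ ∣ y ∣) W) nv) ⟨
  signPow (ellBIncrement W v) ℤ.* signPow (ellB W)     ∎
  where
  open ≡-Reasoning
  cA = count (λ x → ⌊ v ℤ.<? x ⌋) W
  cB = count (λ x → ⌊ (x ℤ.+ v) ℤ.<? + 0 ⌋) W
  nv = boolToℕ (isNeg v)
  shuffle : ∀ i cA a n b cB → (i + cA) + (a + n) + (b + cB) ≡ ((cA + cB) + n) + (i + a + b)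
  shuffle = ℕRS.solve-∀
  regroup : ellB (W ++ v ∷ []) ≡ ((cA + cB) + nv) + ellB W
  regroup = trans (cong₂ _+_ (cong₂ _+_ (inv-∷ʳ W v) (count-∷ʳ _ W v)) (N2-∷ʳ W v)) (shuffle (inv W) cA (N1 W) nv (N2 W) cB)

descentAt : ℤ → ℤ → ℕ → ℕ
descentAt v u L = if precB v u then suc L else 0

fmajIncrement : ℤ → ℤ → ℕ → ℕ
fmajIncrement v u L = 2 * descentAt v u L + boolToℕ (isNeg v)

fmaj-∷ʳ : ∀ w u v → fmaj ((w ++ u ∷ []) ++ v ∷ []) ≡ fmajIncrement v u (length w) + fmaj (w ++ u ∷ [])
fmaj-∷ʳ w u v =
  trans (cong₂ (λ m n → 2 * m + n) (majFrom-∷ʳ 1 w u v) (count-∷ʳ _ (w ++ u ∷ []) v))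
        (shuffle (maj (w ++ u ∷ [])) _ (N1 (w ++ u ∷ [])) _)
  where
  shuffle : ∀ m d a n → 2 * (m + d) + (a + n) ≡ (2 * d + n) + (2 * m + a)
  shuffle = ℕRS.solve-∀

weight : List ℤ → Poly
weight γ = monomial (signPow (ellB γ)) (fmaj γ)

weight-∷ʳ : ∀ w u v → All (λ y → ¬ ∣ y ∣ ≡ ∣ v ∣) (w ++ u ∷ []) →
  weight ((w ++ u ∷ []) ++ v ∷ [])
    ≈ monomial (signPow (ellBIncrement (w ++ u ∷ []) v)) (fmajIncrement v u (length w)) *P weight (w ++ u ∷ [])
weight-∷ʳ w u v ne = ≈-trans
  (≈-reflexive (cong₂ monomial (ellB-∷ʳ (w ++ u ∷ []) v ne) (fmaj-∷ʳ w u v)))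
  (≈-sym (monomial-*P-monomial _ (fmajIncrement v u (length w)) _ (fmaj (w ++ u ∷ []))))

lastPos-∷ʳ : ∀ w v → lastPos (w ++ v ∷ []) ≡ isPos v
lastPos-∷ʳ []          v = refl
lastPos-∷ʳ (x ∷ [])    v = refl
lastPos-∷ʳ (x ∷ y ∷ w) v = lastPos-∷ʳ (y ∷ w) v

absDistinct-∷ʳ : ∀ w v → absDistinct (w ++ v ∷ []) ≡ absDistinct w ∧ allB (λ y → not ⌊ ∣ y ∣ ℕ.≟ ∣ v ∣ ⌋) w
absDistinct-∷ʳ []      v = refl
absDistinct-∷ʳ (x ∷ w) v = trans (cong₂ _∧_ (allB-∷ʳ (λ y → not ⌊ ∣ x ∣ ℕ.≟ ∣ y ∣ ⌋) w v) (absDistinct-∷ʳ w v))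
                                 (∧-interchange (allB (λ y → not ⌊ ∣ x ∣ ℕ.≟ ∣ y ∣ ⌋) w) _ (absDistinct w) _)

_∖_ : (ℕ → Bool) → ℕ → ℕ → Bool
(S ∖ a) b = S b ∧ not (b ≡ᵇ a)

distinctWithin : (ℕ → Bool) → List ℤ → Bool
distinctWithin S w = absDistinct w ∧ allB (λ x → S ∣ x ∣) w

distinctWithin-∷ʳ : ∀ S w v → distinctWithin S (w ++ v ∷ []) ≡ distinctWithin (S ∖ ∣ v ∣) w ∧ S ∣ v ∣
distinctWithin-∷ʳ S w v = begin
  absDistinct (w ++ v ∷ []) ∧ allB (λ x → S ∣ x ∣) (w ++ v ∷ [])
    ≡⟨ cong₂ _∧_ (absDistinct-∷ʳ w v) (allB-∷ʳ (λ x → S ∣ x ∣) w v) ⟩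
  (absDistinct w ∧ fresh) ∧ (allB (λ x → S ∣ x ∣) w ∧ S ∣ v ∣)
    ≡⟨ BP.∧-assoc (absDistinct w ∧ fresh) _ _ ⟨
  ((absDistinct w ∧ fresh) ∧ allB (λ x → S ∣ x ∣) w) ∧ S ∣ v ∣
    ≡⟨ cong (_∧ S ∣ v ∣) (trans (BP.∧-assoc (absDistinct w) fresh _) (cong (absDistinct w ∧_) (BP.∧-comm fresh _))) ⟩
  (absDistinct w ∧ (allB (λ x → S ∣ x ∣) w ∧ fresh)) ∧ S ∣ v ∣
    ≡⟨ cong (λ b → (absDistinct w ∧ b) ∧ S ∣ v ∣) (sym within-∖) ⟩
  distinctWithin (S ∖ ∣ v ∣) w ∧ S ∣ v ∣ ∎
  where
  open ≡-Reasoning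
  fresh = allB (λ y → not ⌊ ∣ y ∣ ℕ.≟ ∣ v ∣ ⌋) w
  within-∖ : allB (λ x → (S ∖ ∣ v ∣) ∣ x ∣) w ≡ allB (λ x → S ∣ x ∣) w ∧ fresh
  within-∖ = trans (allB-∧ (λ x → S ∣ x ∣) _ w)
                   (cong (allB (λ x → S ∣ x ∣) w ∧_) (allB-cong w (λ x → cong not (sym (isYes≗does (∣ x ∣ ℕ.≟ ∣ v ∣))))))

distinctWithin-∷ʳ⇒fresh : ∀ S w v → distinctWithin S (w ++ v ∷ []) ≡ true → All (λ y → ¬ ∣ y ∣ ≡ ∣ v ∣) w
distinctWithin-∷ʳ⇒fresh S w v h =
  All.map (λ {y} e → toWitnessFalse (subst T (sym e) tt))
          (allB⇒All _ w (proj₂ (∧-true⇒ {absDistinct w} (trans (sym (absDistinct-∷ʳ w v)) (proj₁ (∧-true⇒ h))))))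

distinctWithin-∷ : ∀ S x W → distinctWithin S (x ∷ W) ≡ true → S ∣ x ∣ ≡ true × distinctWithin (S ∖ ∣ x ∣) W ≡ true
distinctWithin-∷ S x W h = Sx , cong₂ _∧_ distinct within
  where
  fresh×distinct = ∧-true⇒ {allB (λ y → not ⌊ ∣ x ∣ ℕ.≟ ∣ y ∣ ⌋) W} (proj₁ (∧-true⇒ h))
  Sx×within = ∧-true⇒ {S ∣ x ∣} (proj₂ (∧-true⇒ {absDistinct (x ∷ W)} h))
  Sx = proj₁ Sx×within
  distinct = proj₂ fresh×distinct
  within : allB (λ y → (S ∖ ∣ x ∣) ∣ y ∣) W ≡ true
  within = trans (allB-∧ (λ y → S ∣ y ∣) _ W) (cong₂ _∧_ (proj₂ Sx×within) (trans (allB-cong W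
    (λ y → cong not (trans (≡ᵇ-sym ∣ y ∣ ∣ x ∣) (sym (isYes≗does (∣ x ∣ ℕ.≟ ∣ y ∣)))))) (proj₁ fresh×distinct)))

distinctWithin-all : ∀ w → distinctWithin (λ _ → true) w ≡ absDistinct w
distinctWithin-all w = trans (cong (absDistinct w ∧_) (allB-true w)) (BP.∧-identityʳ _)
  where
  allB-true : ∀ w → allB (λ (_ : ℤ) → true) w ≡ true
  allB-true []      = refl
  allB-true (x ∷ w) = allB-true w

countRange : (ℕ → Bool) → ℕ → ℕ
countRange P zero    = 0
countRange P (suc n) = boolToℕ (P 1) + countRange (λ b → P (suc b)) n

countRange-cong : ∀ {P Q : ℕ → Bool} n → (∀ b → P (suc b) ≡ Q (suc b)) → countRange P n ≡ countRange Q n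
countRange-cong zero    e = refl
countRange-cong (suc n) e = cong₂ _+_ (cong boolToℕ (e 0)) (countRange-cong n (λ b → e (suc b)))

countRange-all : ∀ n → countRange (λ _ → true) n ≡ n
countRange-all zero    = refl
countRange-all (suc n) = cong suc (countRange-all n)

countRange-∧-≤ : ∀ (P Q : ℕ → Bool) n → countRange (λ b → P b ∧ Q b) n ℕ.≤ countRange P n
countRange-∧-≤ P Q zero    = z≤n
countRange-∧-≤ P Q (suc n) =
  ℕP.+-mono-≤ (boolToℕ-∧-≤ (P 1) (Q 1)) (countRange-∧-≤ (λ b → P (suc b)) (λ b → Q (suc b)) n)
  where
  boolToℕ-∧-≤ : ∀ a b → boolToℕ (a ∧ b) ℕ.≤ boolToℕ a
  boolToℕ-∧-≤ true  true  = ℕP.≤-refl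
  boolToℕ-∧-≤ true  false = z≤n
  boolToℕ-∧-≤ false b     = z≤n

countRange-remove : ∀ (P : ℕ → Bool) n i → i ℕ.< n →
  countRange P n ≡ boolToℕ (P (suc i)) + countRange (P ∖ suc i) n
countRange-remove P (suc n) zero    _ =
  cong₂ (λ x y → boolToℕ (P 1) + (boolToℕ x + y)) (sym (BP.∧-zeroʳ (P 1)))
        (countRange-cong n (λ b → sym (BP.∧-identityʳ (P (suc (suc b))))))
countRange-remove P (suc n) (suc i) (ℕ.s≤s i<n) = begin
  boolToℕ (P 1) + countRange (λ b → P (suc b)) n
    ≡⟨ cong (λ c → boolToℕ (P 1) + c) (countRange-remove (λ b → P (suc b)) n i i<n) ⟩
  boolToℕ (P 1) + (boolToℕ (P (suc (suc i))) + rest)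
    ≡⟨ +-left-comm (boolToℕ (P 1)) _ rest ⟩
  boolToℕ (P (suc (suc i))) + (boolToℕ (P 1) + rest)
    ≡⟨ cong (λ x → boolToℕ (P (suc (suc i))) + (boolToℕ x + rest)) (sym (BP.∧-identityʳ (P 1))) ⟩
  boolToℕ (P (suc (suc i))) + countRange (P ∖ suc (suc i)) (suc n) ∎
  where
  open ≡-Reasoning
  rest = countRange (λ b → P (suc b) ∧ not (b ≡ᵇ suc i)) n

countRange-∖ : ∀ (S : ℕ → Bool) n i M → i ℕ.< n → S (suc i) ≡ true → countRange S n ≡ suc M →
               countRange (S ∖ suc i) n ≡ M
countRange-∖ S n i M i<n Si e = ℕP.suc-injective (begin
  suc (countRange (S ∖ suc i) n)                       ≡⟨ cong (λ b → boolToℕ b + countRange (S ∖ suc i) n) Si ⟨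
  boolToℕ (S (suc i)) + countRange (S ∖ suc i) n       ≡⟨ countRange-remove S n i i<n ⟨
  countRange S n                                       ≡⟨ e ⟩
  suc M                                                ∎)
  where open ≡-Reasoning

count-distinctWithin : ∀ n S W → distinctWithin S W ≡ true → All (Letter n) W → countRange S n ≡ length W →
                       ∀ (Q : ℕ → Bool) → count (λ x → Q ∣ x ∣) W ≡ countRange (λ b → S b ∧ Q b) n
count-distinctWithin n S []      _ _ e Q = sym (ℕP.n≤0⇒n≡0 (ℕP.≤-trans (countRange-∧-≤ S Q n) (ℕP.≤-reflexive e)))
count-distinctWithin n S (x ∷ W) h ((i , ∣x∣≡ , i<n) ∷ letters) e Q = begin
  boolToℕ (Q ∣ x ∣) + count (λ y → Q ∣ y ∣) W
    ≡⟨ cong₂ _+_ (cong (λ a → boolToℕ (Q a)) ∣x∣≡) (count-distinctWithin n (S ∖ suc i) W distinct′ letters e′ Q) ⟩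
  boolToℕ (Q (suc i)) + countRange (λ b → (S ∖ suc i) b ∧ Q b) n
    ≡⟨ cong₂ (λ s c → boolToℕ (s ∧ Q (suc i)) + c) (sym Si) (countRange-cong n (λ b → ∧-swapʳ (S (suc b)) _ (Q (suc b)))) ⟩
  boolToℕ (S (suc i) ∧ Q (suc i)) + countRange ((λ b → S b ∧ Q b) ∖ suc i) n
    ≡⟨ countRange-remove (λ b → S b ∧ Q b) n i i<n ⟨
  countRange (λ b → S b ∧ Q b) n ∎
  where
  open ≡-Reasoning
  Si : S (suc i) ≡ true
  Si = trans (cong S (sym ∣x∣≡)) (proj₁ (distinctWithin-∷ S x W h))
  distinct′ : distinctWithin (S ∖ suc i) W ≡ true
  distinct′ = subst (λ a → distinctWithin (S ∖ a) W ≡ true) ∣x∣≡ (proj₂ (distinctWithin-∷ S x W h))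
  e′ : countRange (S ∖ suc i) n ≡ length W
  e′ = countRange-∖ S n i (length W) i<n Si e

countAbove : (ℕ → Bool) → ℕ → ℕ → ℕ
countAbove P b n = countRange (λ c → P c ∧ (b <ᵇ c)) n

countBelow : (ℕ → Bool) → ℕ → ℕ → ℕ
countBelow P b n = countRange (λ c → P c ∧ (c <ᵇ b)) n

countRange-partition : ∀ (P R : ℕ → Bool) n →
  countRange P n ≡ countRange (λ c → P c ∧ R c) n + countRange (λ c → P c ∧ not (R c)) n
countRange-partition P R zero    = refl
countRange-partition P R (suc n) =
  trans (cong₂ _+_ (boolToℕ-partition (P 1) (R 1)) (countRange-partition (λ b → P (suc b)) (λ b → R (suc b)) n))
        (+-interchange (boolToℕ (P 1 ∧ R 1)) _ _ _)
  where
  boolToℕ-partition : ∀ x r → boolToℕ x ≡ boolToℕ (x ∧ r) + boolToℕ (x ∧ not r)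
  boolToℕ-partition true  true  = refl
  boolToℕ-partition true  false = refl
  boolToℕ-partition false r     = refl

∖-self : ∀ S a → (S ∖ a) a ≡ false
∖-self S a = trans (cong (λ t → S a ∧ not t) (≡ᵇ-refl a)) (BP.∧-zeroʳ (S a))

countAbove-∖-self : ∀ S a n → countAbove (S ∖ a) a n ≡ countAbove S a n
countAbove-∖-self S a n = countRange-cong n (λ c → sym (∧-implied (S (suc c)) (a <ᵇ suc c) _ (<ᵇ⇒≢ᵇ a (suc c))))

countAbove-singleton : ∀ n S i → i ℕ.< n → S (suc i) ≡ true → countRange S n ≡ 1 → countAbove S (suc i) n ≡ 0
countAbove-singleton n S i i<n Si size = ℕP.n≤0⇒n≡0 (subst (ℕ._≤ 0) (countAbove-∖-self S (suc i) n)
  (ℕP.≤-trans (countRange-∧-≤ (S ∖ suc i) (suc i <ᵇ_) n) (ℕP.≤-reflexive (countRange-∖ S n i 0 i<n Si size))))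

module _ (P : ℕ → Bool) (a : ℕ) (Pa : P a ≡ false) where

  not-above≡below : ∀ c → P c ∧ not (a <ᵇ c) ≡ P c ∧ (c <ᵇ a)
  not-above≡below c with compareᵇ a c
  ... | less    p q _ rewrite p | q = refl
  ... | greater p q _ rewrite p | q = refl
  ... | equal   p q r rewrite p | q | ≡ᵇ-true⇒≡ {c} {a} r | Pa = refl

  countRange-split-at : ∀ n → countRange P n ≡ countAbove P a n + countBelow P a n
  countRange-split-at n = trans (countRange-partition P (a <ᵇ_) n)
    (cong (λ c → countAbove P a n + c) (countRange-cong n (λ b → not-above≡below (suc b))))

  guard-split-at : ∀ c F → guard (P c) F ≈ guard (P c ∧ (a <ᵇ c)) F +P guard (P c ∧ (c <ᵇ a)) F
  guard-split-at c F = ≈-trans (split (P c) (a <ᵇ c))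
    (≈-reflexive (cong (λ b → guard (P c ∧ (a <ᵇ c)) F +P guard b F) (not-above≡below c)))
    where
    split : ∀ s t → guard s F ≈ guard (s ∧ t) F +P guard (s ∧ not t) F
    split true  true  = ≈-reflexive (sym (+P-identityʳ F))
    split true  false = ≈-refl
    split false t     = ≈-refl

  countAbove-below-threshold : ∀ b n → (b <ᵇ a) ≡ true →
    countAbove P b n ≡ countAbove (λ c → P c ∧ (c <ᵇ a)) b n + countAbove P a n
  countAbove-below-threshold b n b<a = trans (countRange-partition (λ c → P c ∧ (b <ᵇ c)) (a <ᵇ_) n)
    (trans (cong₂ _+_ (countRange-cong n (λ c → sym (∧-implied (P (suc c)) (a <ᵇ suc c) (b <ᵇ suc c) (<ᵇ-trans b a (suc c) b<a))))
                      (countRange-cong n (λ c → trans (∧-swapʳ (P (suc c)) _ _) (cong (_∧ (b <ᵇ suc c)) (not-above≡below (suc c))))))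
           (ℕP.+-comm (countAbove P a n) _))

countAbove-above-threshold : ∀ (P : ℕ → Bool) a b n → (a <ᵇ b) ≡ true →
  countAbove P b n ≡ countAbove (λ c → P c ∧ (a <ᵇ c)) b n
countAbove-above-threshold P a b n a<b =
  countRange-cong n (λ c → ∧-implied (P (suc c)) (b <ᵇ suc c) (a <ᵇ suc c) (<ᵇ-trans a b (suc c) a<b))

-- Summing over the second-to-last letter

-- As c runs through P ∩ {1, …, n}, the number of elements of P above c takes each value 0, …, |P| - 1 once.
ΣP-guard-rank : ∀ m (P : ℕ → Bool) n off →
  ΣP (upTo n) (λ i → guard (P (suc i)) (signedQPow m (off + countAbove P (suc i) n))) ≈ geom m off (countRange P n)
ΣP-guard-rank m P zero    off = ≈-refl
ΣP-guard-rank m P (suc n) off = begin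
  ΣP (upTo (suc n)) (λ i → guard (P (suc i)) (signedQPow m (off + countAbove P (suc i) (suc n))))
    ≈⟨ ΣP-upTo-suc n _ ⟩
  guard (P 1) (signedQPow m (off + countAbove P 1 (suc n))) +P
    ΣP (upTo n) (λ i → guard (P (suc (suc i))) (signedQPow m (off + countAbove P (suc (suc i)) (suc n))))
    ≈⟨ +P-cong (≈-reflexive (cong (λ c → guard (P 1) (signedQPow m (off + c))) countAbove-1))
               (ΣP-cong (upTo n) (λ i → ≈-reflexive (cong (λ c → guard (P (suc (suc i))) (signedQPow m (off + c))) (countAbove-suc i)))) ⟩
  guard (P 1) (signedQPow m (off + rest)) +P
    ΣP (upTo n) (λ i → guard (P (suc (suc i))) (signedQPow m (off + countAbove (λ b → P (suc b)) (suc i) n)))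
    ≈⟨ +P-cong (≈-refl {guard (P 1) _}) (ΣP-guard-rank m (λ b → P (suc b)) n off) ⟩
  guard (P 1) (signedQPow m (off + rest)) +P geom m off rest
    ≈⟨ prepend (P 1) ⟩
  geom m off (countRange P (suc n)) ∎
  where
  open ≈-Reasoning
  rest = countRange (λ b → P (suc b)) n
  countAbove-1 : countAbove P 1 (suc n) ≡ rest
  countAbove-1 = cong₂ _+_ (cong boolToℕ (BP.∧-zeroʳ (P 1))) (countRange-cong n (λ b → BP.∧-identityʳ (P (suc (suc b)))))
  countAbove-suc : ∀ i → countAbove P (suc (suc i)) (suc n) ≡ countAbove (λ b → P (suc b)) (suc i) n
  countAbove-suc i = cong (λ x → boolToℕ x + countAbove (λ b → P (suc b)) (suc i) n) (BP.∧-zeroʳ (P 1))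
  prepend : ∀ b → guard b (signedQPow m (off + rest)) +P geom m off rest ≈ geom m off (boolToℕ b + rest)
  prepend true  = geom-∷ʳ m off rest
  prepend false = ≈-refl

ΣP-guard-rank-split : ∀ m (P : ℕ → Bool) a → P a ≡ false → ∀ n X Y →
  ΣP (upTo n) (λ i → guard (P (suc i)) (signedQPow m ((if a <ᵇ suc i then X else Y) + countAbove P (suc i) n)))
    ≈ geom m X (countAbove P a n) +P geom m (Y + countAbove P a n) (countBelow P a n)
ΣP-guard-rank-split m P a Pa n X Y = begin
  ΣP (upTo n) (λ i → guard (P (suc i)) (F i))
    ≈⟨ ΣP-cong (upTo n) (λ i → guard-split-at P a Pa (suc i) (F i)) ⟩
  ΣP (upTo n) (λ i → guard (P (suc i) ∧ (a <ᵇ suc i)) (F i) +P guard (P (suc i) ∧ (suc i <ᵇ a)) (F i))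
    ≈⟨ ΣP-+P (upTo n) _ _ ⟩
  ΣP (upTo n) (λ i → guard (P (suc i) ∧ (a <ᵇ suc i)) (F i)) +P ΣP (upTo n) (λ i → guard (P (suc i) ∧ (suc i <ᵇ a)) (F i))
    ≈⟨ +P-cong (≈-trans (ΣP-cong (upTo n) (λ i → guard-cong refl (λ h → ≈-reflexive (cong (signedQPow m) (above i h)))))
                        (ΣP-guard-rank m Above n X))
               (≈-trans (ΣP-cong (upTo n) (λ i → guard-cong refl (λ h → ≈-reflexive (cong (signedQPow m) (below i h)))))
                        (ΣP-guard-rank m Below n (Y + p))) ⟩
  geom m X p +P geom m (Y + p) (countBelow P a n) ∎
  where
  open ≈-Reasoning
  F : ℕ → Poly
  F i = signedQPow m ((if a <ᵇ suc i then X else Y) + countAbove P (suc i) n)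
  Above Below : ℕ → Bool
  Above c = P c ∧ (a <ᵇ c)
  Below c = P c ∧ (c <ᵇ a)
  p = countAbove P a n
  above : ∀ i → Above (suc i) ≡ true → (if a <ᵇ suc i then X else Y) + countAbove P (suc i) n ≡ X + countAbove Above (suc i) n
  above i h rewrite proj₂ (∧-true⇒ {P (suc i)} h) =
    cong (_+_ X) (countAbove-above-threshold P a (suc i) n (proj₂ (∧-true⇒ {P (suc i)} h)))
  below : ∀ i → Below (suc i) ≡ true → (if a <ᵇ suc i then X else Y) + countAbove P (suc i) n ≡ (Y + p) + countAbove Below (suc i) n
  below i h rewrite <ᵇ-asym (suc i) a (proj₂ (∧-true⇒ {P (suc i)} h)) =
    trans (cong (_+_ Y) (countAbove-below-threshold P a Pa (suc i) n (proj₂ (∧-true⇒ {P (suc i)} h))))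
          (trans (cong (_+_ Y) (ℕP.+-comm (countAbove Below (suc i) n) p)) (sym (ℕP.+-assoc Y p _)))

lastLetterExp : ℕ → (ℕ → Bool) → ℕ → ℤ → ℕ
lastLetterExp n S m u = countAbove S ∣ u ∣ n + (if isNeg u then m else 0)

descentSum : ℕ → (ℕ → Bool) → ℕ → ℤ → Poly
descentSum n S M′ v =
  ΣP (alphabet n) (λ u → guard (S ∣ u ∣) (signedQPow (suc M′) (2 * descentAt v u M′ + lastLetterExp n S (suc M′) u)))

module _ (n M′ : ℕ) (S : ℕ → Bool) (i₀ : ℕ) (size : countRange (S ∖ suc i₀) n ≡ suc M′) where
  private
    M = suc M′
    S′ = S ∖ suc i₀
    p = countAbove S′ (suc i₀) n
    r = countBelow S′ (suc i₀) n

    p+r≡M : p + r ≡ M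
    p+r≡M = trans (sym (countRange-split-at S′ (suc i₀) (∖-self S (suc i₀)) n)) size

    rank : ∀ off → ΣP (upTo n) (λ i → guard (S′ (suc i)) (signedQPow M (off + countAbove S′ (suc i) n))) ≈ geom M off M
    rank off = ≈-trans (ΣP-guard-rank M S′ n off) (≈-reflexive (cong (geom M off) size))

    split : ∀ X Y →
      ΣP (upTo n) (λ i → guard (S′ (suc i)) (signedQPow M ((if suc i₀ <ᵇ suc i then X else Y) + countAbove S′ (suc i) n)))
        ≈ geom M X p +P geom M (Y + p) r
    split = ΣP-guard-rank-split M S′ (suc i₀) (∖-self S (suc i₀)) n

    2M≡M+M : 2 * M ≡ M + M
    2M≡M+M = cong (_+_ M) (ℕP.+-identityʳ M)

    assemble : ∀ o → geom M o r +P (geom M (o + r) M +P geom M ((o + r) + M) p) ≈ geom M o (2 * M)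
    assemble o = ≈-trans (≈-sym (geom-++³ M o r M p)) (≈-reflexive (cong (geom M o) length≡2M))
      where
      shuffle : ∀ r M p → r + (M + p) ≡ (p + r) + M
      shuffle = ℕRS.solve-∀
      length≡2M : r + (M + p) ≡ 2 * M
      length≡2M = trans (shuffle r M p) (trans (cong (_+ M) p+r≡M) (sym 2M≡M+M))

    twice-if : ∀ b → 2 * (if b then M else 0) ≡ (if b then 2 * M else 0)
    twice-if true  = refl
    twice-if false = refl

  descentSum-pos : descentSum n S′ M′ (+ suc i₀) ≈ geom M p (2 * M)
  descentSum-pos = begin
    descentSum n S′ M′ (+ suc i₀)
      ≈⟨ ΣP-alphabet n _ ⟩
    ΣP (upTo n) (λ i → guard (S′ (suc i)) (signedQPow M (countAbove S′ (suc i) n + M))) +P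
      ΣP (upTo n) (λ i → guard (S′ (suc i)) (signedQPow M (2 * descentAt (+ suc i₀) (+ suc i) M′ + (countAbove S′ (suc i) n + 0))))
      ≈⟨ +P-cong (≈-trans (ΣP-cong (upTo n) (λ i → ≈-reflexive (cong (λ e → guard (S′ (suc i)) (signedQPow M e)) (ℕP.+-comm _ M))))
                          (rank M))
                 (≈-trans (ΣP-cong (upTo n) (λ i → ≈-reflexive (cong (λ e → guard (S′ (suc i)) (signedQPow M e)) (exponent i))))
                          (split (2 * M) 0)) ⟩
    geom M M M +P (geom M (2 * M) p +P geom M p r)
      ≈⟨ ≈-trans (≈-sym (+P-assoc (geom M M M) _ _)) (+P-comm _ (geom M p r)) ⟩
    geom M p r +P (geom M M M +P geom M (2 * M) p)
      ≡⟨ cong₂ (λ o₁ o₂ → geom M p r +P (geom M o₁ M +P geom M o₂ p)) (sym p+r≡M) (trans 2M≡M+M (cong (_+ M) (sym p+r≡M))) ⟩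
    geom M p r +P (geom M (p + r) M +P geom M ((p + r) + M) p)
      ≈⟨ assemble p ⟩
    geom M p (2 * M) ∎
    where
    open ≈-Reasoning
    exponent : ∀ i → 2 * descentAt (+ suc i₀) (+ suc i) M′ + (countAbove S′ (suc i) n + 0)
                     ≡ (if suc i₀ <ᵇ suc i then 2 * M else 0) + countAbove S′ (suc i) n
    exponent i = cong₂ _+_ (trans (cong (λ b → 2 * (if b then M else 0)) (isYes≗does (suc i₀ ℕ.<? suc i))) (twice-if _))
                           (ℕP.+-identityʳ _)

  descentSum-neg : descentSum n S′ M′ -[1+ i₀ ] ≈ geom M (M + p) (2 * M)
  descentSum-neg = begin
    descentSum n S′ M′ -[1+ i₀ ]
      ≈⟨ ΣP-alphabet n _ ⟩
    ΣP (upTo n) (λ i → guard (S′ (suc i)) (signedQPow M (2 * descentAt -[1+ i₀ ] -[1+ i ] M′ + (countAbove S′ (suc i) n + M)))) +P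
      ΣP (upTo n) (λ i → guard (S′ (suc i)) (signedQPow M (2 * M + (countAbove S′ (suc i) n + 0))))
      ≈⟨ +P-cong (≈-trans (ΣP-cong (upTo n) (λ i → ≈-reflexive (cong (λ e → guard (S′ (suc i)) (signedQPow M e)) (exponent i))))
                          (split (2 * M + M) M))
                 (≈-trans (ΣP-cong (upTo n) (λ i → ≈-reflexive (cong (λ e → guard (S′ (suc i)) (signedQPow M (2 * M + e)))
                                                                            (ℕP.+-identityʳ _))))
                          (rank (2 * M))) ⟩
    (geom M (2 * M + M) p +P geom M (M + p) r) +P geom M (2 * M) M
      ≈⟨ rotate (geom M (2 * M + M) p) (geom M (M + p) r) (geom M (2 * M) M) ⟩
    geom M (M + p) r +P (geom M (2 * M) M +P geom M (2 * M + M) p)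
      ≡⟨ cong₂ (λ o₁ o₂ → geom M (M + p) r +P (geom M o₁ M +P geom M o₂ p)) 2M≡M+p+r (cong (_+ M) 2M≡M+p+r) ⟩
    geom M (M + p) r +P (geom M ((M + p) + r) M +P geom M (((M + p) + r) + M) p)
      ≈⟨ assemble (M + p) ⟩
    geom M (M + p) (2 * M) ∎
    where
    open ≈-Reasoning
    rotate : ∀ a b c → (a +P b) +P c ≈ b +P (c +P a)
    rotate a b c = ≈-trans (+P-cong (+P-comm a b) (≈-refl {c})) (≈-trans (+P-assoc b a c) (+P-cong (≈-refl {b}) (+P-comm a c)))
    2M≡M+p+r : 2 * M ≡ (M + p) + r
    2M≡M+p+r = trans 2M≡M+M (trans (cong (_+_ M) (sym p+r≡M)) (sym (ℕP.+-assoc M p r)))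
    exponent : ∀ i → 2 * descentAt -[1+ i₀ ] -[1+ i ] M′ + (countAbove S′ (suc i) n + M)
                     ≡ (if suc i₀ <ᵇ suc i then 2 * M + M else M) + countAbove S′ (suc i) n
    exponent i rewrite isYes≗does (i₀ ℕ.<? i) with i₀ <ᵇ i
    ... | true  = shuffle (2 * M) (countAbove S′ (suc i) n) M
      where
      shuffle : ∀ a x m → a + (x + m) ≡ (a + m) + x
      shuffle = ℕRS.solve-∀
    ... | false = ℕP.+-comm (countAbove S′ (suc i) n) M

-- Induction on the length

endingSum : ℕ → ℕ → (ℕ → Bool) → ℤ → Poly
endingSum n M S v = ΣP (words n M) (λ w → guard (distinctWithin S (w ++ v ∷ [])) (weight (w ++ v ∷ [])))

EndingSumFormula : ℕ → ℕ → Set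
EndingSumFormula n M = ∀ (S : ℕ → Bool) v → Letter n v → S ∣ v ∣ ≡ true → countRange S n ≡ suc M →
  endingSum n M S v ≈ signedQPow (suc M) (lastLetterExp n S (suc M) v) *P qintProduct M

endingSum-∉ : ∀ n M S u → S ∣ u ∣ ≡ false → endingSum n M S u ≈ []
endingSum-∉ n M S u u∉ = ΣP-zero (words n M) _ (λ w → ≈-reflexive (cong (λ b → guard b (weight (w ++ u ∷ [])))
  (trans (distinctWithin-∷ʳ S w u) (trans (cong (distinctWithin (S ∖ ∣ u ∣) w ∧_) u∉) (BP.∧-zeroʳ _)))))

module EndingSumStep (n M′ : ℕ) (IH : EndingSumFormula n M′) (S : ℕ → Bool) (v : ℤ)
                     (v∈ : S ∣ v ∣ ≡ true) (size′ : countRange (S ∖ ∣ v ∣) n ≡ suc M′) where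
  private
    M  = suc M′
    S′ = S ∖ ∣ v ∣
    σ  = countAbove S′ ∣ v ∣ n + boolToℕ (isNeg v)

    factor : ℤ → Poly
    factor u = monomial (signPow σ) (fmajIncrement v u M′)

    weight-peel : ∀ w u → IsWord n M′ w → Letter n u →
      guard (distinctWithin S ((w ++ u ∷ []) ++ v ∷ [])) (weight ((w ++ u ∷ []) ++ v ∷ []))
        ≈ factor u *P guard (distinctWithin S′ (w ++ u ∷ [])) (weight (w ++ u ∷ []))
    weight-peel w u (length-w , letters) u-letter =
      ≈-trans (guard-cong distinct-peel peel) (guard-*P (distinctWithin S′ W) (factor u) (weight W))
      where
      W = w ++ u ∷ []
      distinct-peel : distinctWithin S (W ++ v ∷ []) ≡ distinctWithin S′ W
      distinct-peel = trans (distinctWithin-∷ʳ S W v) (trans (cong (distinctWithin S′ W ∧_) v∈) (BP.∧-identityʳ _))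
      length-W : countRange S′ n ≡ length W
      length-W = trans size′ (sym (trans (LP.length-++ w) (trans (ℕP.+-comm (length w) 1) (cong suc length-w))))
      peel : distinctWithin S (W ++ v ∷ []) ≡ true → weight (W ++ v ∷ []) ≈ factor u *P weight W
      peel h = ≈-trans (weight-∷ʳ w u v (distinctWithin-∷ʳ⇒fresh S W v h))
        (*P-congˡ (weight W) (≈-reflexive (cong₂ (λ s L → monomial (signPow s) (fmajIncrement v u L))
          (cong (_+ boolToℕ (isNeg v)) (count-distinctWithin n S′ W (trans (sym distinct-peel) h)
                                          (AllP.++⁺ letters (u-letter ∷ [])) length-W (∣ v ∣ <ᵇ_)))
          length-w)))

    endingSum-peel : endingSum n M S v ≈ ΣP (alphabet n) (λ u → factor u *P endingSum n M′ S′ u)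
    endingSum-peel = begin
      endingSum n M S v
        ≈⟨ ΣP-words-∷ʳ n M′ _ ⟩
      ΣP (words n M′) (λ w → ΣP (alphabet n) (λ u → guard (distinctWithin S ((w ++ u ∷ []) ++ v ∷ [])) (weight ((w ++ u ∷ []) ++ v ∷ []))))
        ≈⟨ ΣP-cong-All (words n M′) (words-IsWord n M′) (λ w w-word →
             ΣP-cong-All (alphabet n) (alphabet-Letter n) (λ u u-letter → weight-peel w u w-word u-letter)) ⟩
      ΣP (words n M′) (λ w → ΣP (alphabet n) (λ u → factor u *P guard (distinctWithin S′ (w ++ u ∷ [])) (weight (w ++ u ∷ []))))
        ≈⟨ ΣP-swap (words n M′) (alphabet n) _ ⟩
      ΣP (alphabet n) (λ u → ΣP (words n M′) (λ w → factor u *P guard (distinctWithin S′ (w ++ u ∷ [])) (weight (w ++ u ∷ []))))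
        ≈⟨ ΣP-cong (alphabet n) (λ u → ΣP-*Pˡ (words n M′) _ (factor u)) ⟨
      ΣP (alphabet n) (λ u → factor u *P endingSum n M′ S′ u) ∎
      where open ≈-Reasoning

    factor-*P-endingSum : ∀ u → Letter n u →
      factor u *P endingSum n M′ S′ u ≈ guard (S′ ∣ u ∣) (factor u *P signedQPow M (lastLetterExp n S′ M u)) *P qintProduct M′
    factor-*P-endingSum u u-letter with S′ ∣ u ∣ in u∈
    ... | true  = ≈-trans (*P-congʳ (factor u) (IH S′ u u-letter u∈ size′)) (≈-sym (*P-assoc (factor u) _ _))
    ... | false = ≈-trans (*P-congʳ (factor u) (endingSum-∉ n M′ S′ u u∈)) (*P-zeroʳ (factor u))

    ΣP-descents : ΣP (alphabet n) (λ u → guard (S′ ∣ u ∣) (factor u *P signedQPow M (lastLetterExp n S′ M u)))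
                    ≈ monomial (signPow σ) (boolToℕ (isNeg v)) *P descentSum n S′ M′ v
    ΣP-descents = ≈-trans (ΣP-cong (alphabet n) (λ u → ≈-trans
        (guard-cong refl (λ _ → monomial-*P-signedQPow-even M (signPow σ) (descentAt v u M′) (boolToℕ (isNeg v)) (lastLetterExp n S′ M u)))
        (guard-*P (S′ ∣ u ∣) (monomial (signPow σ) (boolToℕ (isNeg v))) _)))
      (≈-sym (ΣP-*Pˡ (alphabet n) _ (monomial (signPow σ) (boolToℕ (isNeg v)))))

  endingSum-suc : ∀ off e → descentSum n S′ M′ v ≈ geom M off (2 * M) →
                  monomial (signPow σ) (boolToℕ (isNeg v)) *P signedQPow M off ≈ signedQPow (suc M) e →
                  endingSum n M S v ≈ signedQPow (suc M) e *P qintProduct M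
  endingSum-suc off e descents leading = begin
    endingSum n M S v
      ≈⟨ endingSum-peel ⟩
    ΣP (alphabet n) (λ u → factor u *P endingSum n M′ S′ u)
      ≈⟨ ΣP-cong-All (alphabet n) (alphabet-Letter n) (λ u → factor-*P-endingSum u) ⟩
    ΣP (alphabet n) (λ u → guard (S′ ∣ u ∣) (factor u *P signedQPow M (lastLetterExp n S′ M u)) *P qintProduct M′)
      ≈⟨ ΣP-*Pʳ (alphabet n) _ (qintProduct M′) ⟨
    ΣP (alphabet n) (λ u → guard (S′ ∣ u ∣) (factor u *P signedQPow M (lastLetterExp n S′ M u))) *P qintProduct M′
      ≈⟨ *P-congˡ (qintProduct M′) ΣP-descents ⟩
    (lead *P descentSum n S′ M′ v) *P qintProduct M′
      ≈⟨ *P-congˡ (qintProduct M′) (*P-congʳ lead (≈-trans descents (≈-sym (signedQPow-*P-qintSigned M off (2 * M))))) ⟩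
    (lead *P (signedQPow M off *P qintSigned M (2 * M))) *P qintProduct M′
      ≈⟨ *P-congˡ (qintProduct M′) (≈-trans (≈-sym (*P-assoc lead _ _)) (*P-congˡ (qintSigned M (2 * M)) leading)) ⟩
    (signedQPow (suc M) e *P qintSigned M (2 * M)) *P qintProduct M′
      ≈⟨ *P-assoc (signedQPow (suc M) e) _ _ ⟩
    signedQPow (suc M) e *P (qintSigned M (2 * M) *P qintProduct M′)
      ≈⟨ *P-congʳ (signedQPow (suc M) e) (≈-trans (*P-comm (qintSigned M (2 * M)) _) (≈-sym (qintProduct-suc M′))) ⟩
    signedQPow (suc M) e *P qintProduct M ∎
    where
    open ≈-Reasoning
    lead = monomial (signPow σ) (boolToℕ (isNeg v))

endingSumFormula : ∀ n M → EndingSumFormula n M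
endingSumFormula n zero S v (i , ∣v∣≡ , i<n) v∈ size = begin
  guard (distinctWithin S (v ∷ [])) (weight (v ∷ [])) +P []   ≡⟨ +P-identityʳ _ ⟩
  guard (distinctWithin S (v ∷ [])) (weight (v ∷ []))         ≈⟨ guard-cong (cong (_∧ true) v∈) (λ _ → single v ∣v∣≡ v∈) ⟩
  signedQPow 1 (lastLetterExp n S 1 v)                        ≈⟨ *P-identityʳ _ ⟨
  signedQPow 1 (lastLetterExp n S 1 v) *P qintProduct 0       ∎
  where
  open ≈-Reasoning
  single : ∀ v → ∣ v ∣ ≡ suc i → S ∣ v ∣ ≡ true → weight (v ∷ []) ≈ signedQPow 1 (lastLetterExp n S 1 v)
  single (+ c)    refl v∈ = ≈-reflexive (cong (λ a → signedQPow 1 (a + 0)) (sym (countAbove-singleton n S i i<n v∈ size)))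
  single -[1+ c ] refl v∈ = ≈-reflexive (cong (λ a → signedQPow 1 (a + 1)) (sym (countAbove-singleton n S i i<n v∈ size)))
endingSumFormula n (suc M′) S (+ zero) (i , () , i<n) v∈ size
endingSumFormula n (suc M′) S (+ suc c) (i , ∣v∣≡ , i<n) v∈ size =
  EndingSumStep.endingSum-suc n M′ (endingSumFormula n M′) S (+ suc c) v∈ size′ p (A + 0)
    (descentSum-pos n M′ S c size′)
    (monomial-*P-signedQPow (suc M′) (p + 0) 0 p (A + 0) 0 (trans p≡A (sym (ℕP.+-identityʳ A))) parity)
  where
  c<n = subst (ℕ._< n) (sym (ℕP.suc-injective ∣v∣≡)) i<n
  size′ = countRange-∖ S n c (suc M′) c<n v∈ size
  p = countAbove (S ∖ suc c) (suc c) n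
  A = countAbove S (suc c) n
  p≡A = countAbove-∖-self S (suc c) n
  identity : ∀ M p → (p + 0) + M * p + 2 * 0 ≡ suc M * (p + 0)
  identity = ℕRS.solve-∀
  parity = trans (identity (suc M′) p) (cong (λ a → suc (suc M′) * (a + 0)) p≡A)
endingSumFormula n (suc M′) S -[1+ c ] (i , ∣v∣≡ , i<n) v∈ size =
  EndingSumStep.endingSum-suc n M′ (endingSumFormula n M′) S -[1+ c ] v∈ size′ (M + p) (A + suc M)
    (descentSum-neg n M′ S c size′)
    (monomial-*P-signedQPow M (p + 1) 1 (M + p) (A + suc M) M exponent parity)
  where
  M = suc M′
  c<n = subst (ℕ._< n) (sym (ℕP.suc-injective ∣v∣≡)) i<n
  size′ = countRange-∖ S n c M c<n v∈ size
  p = countAbove (S ∖ suc c) (suc c) n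
  A = countAbove S (suc c) n
  p≡A = countAbove-∖-self S (suc c) n
  exponent-identity : ∀ M p → 1 + (M + p) ≡ p + suc M
  exponent-identity = ℕRS.solve-∀
  exponent = trans (exponent-identity M p) (cong (_+ suc M) p≡A)
  parity-identity : ∀ M p → (p + 1) + M * (M + p) + 2 * M ≡ suc M * (p + suc M)
  parity-identity = ℕRS.solve-∀
  parity = trans (parity-identity M p) (cong (λ a → suc M * (a + suc M)) p≡A)

ΣP-Deltan≈ΣP-endingSum : ∀ m → let n = suc m in
  ΣP (Deltan n) weight ≈ ΣP (alphabet n) (λ v → guard (isPos v) (endingSum n m (λ _ → true) v))
ΣP-Deltan≈ΣP-endingSum m = begin
  ΣP (Deltan n) weight
    ≈⟨ ΣP-filter lastPos (Bn n) weight ⟩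
  ΣP (Bn n) (λ γ → guard (lastPos γ) (weight γ))
    ≈⟨ ΣP-filter absDistinct (words n n) _ ⟩
  ΣP (words n n) (λ γ → guard (absDistinct γ) (guard (lastPos γ) (weight γ)))
    ≈⟨ ΣP-words-∷ʳ n m _ ⟩
  ΣP (words n m) (λ w → ΣP (alphabet n) (λ v → guard (absDistinct (w ++ v ∷ [])) (guard (lastPos (w ++ v ∷ [])) (weight (w ++ v ∷ [])))))
    ≈⟨ ΣP-cong (words n m) (λ w → ΣP-cong (alphabet n) (λ v → ≈-reflexive (last-positive w v))) ⟩
  ΣP (words n m) (λ w → ΣP (alphabet n) (λ v → guard (isPos v) (guard (distinctWithin all (w ++ v ∷ [])) (weight (w ++ v ∷ [])))))
    ≈⟨ ΣP-swap (words n m) (alphabet n) _ ⟩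
  ΣP (alphabet n) (λ v → ΣP (words n m) (λ w → guard (isPos v) (guard (distinctWithin all (w ++ v ∷ [])) (weight (w ++ v ∷ [])))))
    ≈⟨ ΣP-cong (alphabet n) (λ v → ΣP-guard (words n m) (isPos v) _) ⟩
  ΣP (alphabet n) (λ v → guard (isPos v) (endingSum n m all v)) ∎
  where
  open ≈-Reasoning
  n = suc m
  all : ℕ → Bool
  all _ = true
  last-positive : ∀ w v → guard (absDistinct (w ++ v ∷ [])) (guard (lastPos (w ++ v ∷ [])) (weight (w ++ v ∷ [])))
                           ≡ guard (isPos v) (guard (distinctWithin all (w ++ v ∷ [])) (weight (w ++ v ∷ [])))
  last-positive w v =
    trans (cong₂ (λ a b → guard a (guard b (weight (w ++ v ∷ [])))) (sym (distinctWithin-all (w ++ v ∷ []))) (lastPos-∷ʳ w v))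
          (guard-swap (distinctWithin all (w ++ v ∷ [])) (isPos v) _)

ΣP-positive-endingSum : ∀ m → let n = suc m in
  ΣP (alphabet n) (λ v → guard (isPos v) (endingSum n m (λ _ → true) v)) ≈ qintProduct m *P geom n 0 n
ΣP-positive-endingSum m = begin
  ΣP (alphabet n) (λ v → guard (isPos v) (endingSum n m all v))
    ≈⟨ ΣP-cong-All (alphabet n) {f = λ v → guard (isPos v) (endingSum n m all v)} (alphabet-Letter n) (λ v v-letter →
         guard-cong refl (λ _ → endingSumFormula n m all v v-letter refl (countRange-all n))) ⟩
  ΣP (alphabet n) (λ v → guard (isPos v) (signedQPow n (lastLetterExp n all n v) *P qintProduct m))
    ≈⟨ ΣP-alphabet n (λ v → guard (isPos v) (signedQPow n (lastLetterExp n all n v) *P qintProduct m)) ⟩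
  ΣP (upTo n) (λ i → []) +P ΣP (upTo n) (λ i → signedQPow n (countAbove all (suc i) n + 0) *P qintProduct m)
    ≈⟨ +P-cong (ΣP-zero (upTo n) _ (λ _ → ≈-refl)) ≈-refl ⟩
  ΣP (upTo n) (λ i → signedQPow n (countAbove all (suc i) n + 0) *P qintProduct m)
    ≈⟨ ΣP-*Pʳ (upTo n) (λ i → signedQPow n (countAbove all (suc i) n + 0)) (qintProduct m) ⟨
  ΣP (upTo n) (λ i → signedQPow n (countAbove all (suc i) n + 0)) *P qintProduct m
    ≈⟨ *P-congˡ (qintProduct m) (ΣP-cong (upTo n) (λ i → ≈-reflexive (cong (signedQPow n) (ℕP.+-identityʳ (countAbove all (suc i) n))))) ⟩
  ΣP (upTo n) (λ i → guard (all (suc i)) (signedQPow n (0 + countAbove all (suc i) n))) *P qintProduct m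
    ≈⟨ *P-congˡ (qintProduct m) (ΣP-guard-rank n all n 0) ⟩
  geom n 0 (countRange all n) *P qintProduct m
    ≡⟨ cong (λ l → geom n 0 l *P qintProduct m) (countRange-all n) ⟩
  geom n 0 n *P qintProduct m
    ≈⟨ *P-comm _ (qintProduct m) ⟩
  qintProduct m *P geom n 0 n ∎
  where
  open ≈-Reasoning
  n = suc m
  all : ℕ → Bool
  all _ = true

lhsPoly≈rhsPoly : ∀ k → let n = suc (2 * k) in lhsPoly n ≈ rhsPoly n
lhsPoly≈rhsPoly k = begin
  ΣP (Deltan n) weight                                                 ≈⟨ ΣP-Deltan≈ΣP-endingSum (2 * k) ⟩
  ΣP (alphabet n) (λ v → guard (isPos v) (endingSum n (2 * k) (λ _ → true) v)) ≈⟨ ΣP-positive-endingSum (2 * k) ⟩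
  qintProduct (2 * k) *P geom n 0 n                                    ≈⟨ *P-congʳ (qintProduct (2 * k)) (qintNeg≈geom k) ⟨
  qintProduct (2 * k) *P qintNeg n                                     ∎
  where
  open ≈-Reasoning
  n = suc (2 * k)

corollary4p4 : (k : ℕ) → let n = 2 * k + 1 in
    (d : ℕ) → coeff (lhsPoly n) d ≡ coeff (rhsPoly n) d
corollary4p4 k = at (subst (λ n → lhsPoly n ≈ rhsPoly n) (ℕP.+-comm 1 (2 * k)) (lhsPoly≈rhsPoly k))
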